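{- Let $p$ be an odd prime, $q$ a power of $p$, $k$ an integer with $0\le k\le p-1$, and $n\ge 0$ an integer. Let $V=\{y\in\mathbb{F}_{q^2}: y^q=1-y\}$ and $S=(\mathbb{F}_q\cup V)\setminus\{\tfrac12\}\subseteq\mathbb{F}_{q^2}$. For $y\in\mathbb{F}_{q^2}\setminus\{\tfrac12\}$ put $$g(y)=k\,\frac{y^n(1-y)-y(1-y)^n}{2y-1}+y^n+(1-y)^n.$$ Then $D_{n,k}(1,x)$ is a permutation polynomial of $\mathbb{F}_q$ if and only if $g$ is a 2-to-1 mapping on $S$ and $g(y)\neq\frac{k(n-1)+2}{2^n}$ for every $y\in S$.
   Context: For an integer $n\ge1$, $D_{n,k}(1,x)=\sum_{i=0}^{\lfloor n/2\rfloor}\frac{n-ki}{n-i}\binom{n-i}{i}(-x)^i\in\mathbb{F}_q[x]$ (the coefficients are integers, reduced mod $p$), and $D_{0,k}(1,x)=2-k$. A permutation polynomial of $\mathbb{F}_q$ is a polynomial inducing a bijection of $\mathbb{F}_q$. Note $g(y)=g(1-y)$ and $S$ is stable under $y\mapsto 1-y$ with no fixed points; "$g$ is a 2-to-1 mapping on $S$" means that for $y_1,y_2\in S$, $g(y_1)=g(y_2)$ holds if and only if $y_2\in\{y_1,1-y_1\}$. -}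

module Defs where

open import Level using (0ℓ)
open import Data.Nat as ℕ using (ℕ; zero; suc; _∸_; _<_)
open import Data.Nat.Combinatorics using (_C_)
open import Data.Integer as ℤ using (ℤ; +_; -[1+_])
open import Data.Integer.DivMod using (_/ℕ_)
open import Data.Fin using (Fin)
open import Data.Product using (Σ; ∃; _×_)
open import Data.Sum using (_⊎_)
open import Relation.Nullary using (¬_)
open import Relation.Binary using (Decidable)
open import Relation.Binary.PropositionalEquality as ≡ using ()
open import Function.Bundles using (Bijection; _⇔_)
open import Algebra.Bundles using (CommutativeRing)

record FieldOfOrder (m : ℕ) : Set₁ where
  field
    commRing : CommutativeRing 0ℓ 0ℓ
  open CommutativeRing commRing public
  field
    _⁻¹      : Carrier → Carrier
    inverseʳ : ∀ x → ¬ (x ≈ 0#) → x * (x ⁻¹) ≈ 1#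
    0≉1      : ¬ (0# ≈ 1#)
    _≟_      : Decidable _≈_
    enum     : Bijection (≡.setoid (Fin m)) setoid

-- The integer coefficient  (n - k i)/(n - i) * binom(n-i, i)  of D_{n,k}(1,x)
-- (exact division; n - i ≥ 1 in the range used).
coef : ℕ → ℕ → ℕ → ℤ
coef n k i with n ∸ i
... | zero  = + 0
... | suc m = ((+ n ℤ.- (+ k ℤ.* + i)) ℤ.* + ((n ∸ i) C i)) /ℕ (suc m)

module FF {m : ℕ} (F : FieldOfOrder m) where
  open FieldOfOrder F

  pow : Carrier → ℕ → Carrier
  pow x zero    = 1#
  pow x (suc n) = x * pow x n

  fromℕ : ℕ → Carrier
  fromℕ zero    = 0#
  fromℕ (suc n) = 1# + fromℕ n

  fromℤ : ℤ → Carrier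
  fromℤ (+ n)     = fromℕ n
  fromℤ -[1+ n ]  = - fromℕ (suc n)

  _/_ : Carrier → Carrier → Carrier
  x / y = x * (y ⁻¹)

  two : Carrier
  two = 1# + 1#

  half : Carrier
  half = two ⁻¹

  sumTo : ℕ → (ℕ → Carrier) → Carrier
  sumTo zero    f = f 0
  sumTo (suc b) f = sumTo b f + f (suc b)

  D : ℕ → ℕ → Carrier → Carrier
  D zero    k x = fromℤ (+ 2 ℤ.- + k)
  D (suc n) k x = sumTo (suc n ℕ./ 2) (λ i → fromℤ (coef (suc n) k i) * pow (- x) i)

  InFq : ℕ → Carrier → Set
  InFq q y = pow y q ≈ y

  InV : ℕ → Carrier → Set
  InV q y = pow y q ≈ 1# - y

  InS : ℕ → Carrier → Set
  InS q y = (InFq q y ⊎ InV q y) × ¬ (y ≈ half)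

  IsPermutationPolynomial : ℕ → (Carrier → Carrier) → Set
  IsPermutationPolynomial q f =
      (∀ x → InFq q x → InFq q (f x))
    × (∀ x y → InFq q x → InFq q y → f x ≈ f y → x ≈ y)
    × (∀ z → InFq q z → ∃ λ x → InFq q x × f x ≈ z)

  g : ℕ → ℕ → Carrier → Carrier
  g k n y = fromℕ k * ((pow y n * (1# - y) - y * pow (1# - y) n) / (two * y - 1#))
            + pow y n + pow (1# - y) n

  TwoToOneOnS : ℕ → ℕ → ℕ → Set
  TwoToOneOnS q k n = ∀ y₁ y₂ → InS q y₁ → InS q y₂ →
    (g k n y₁ ≈ g k n y₂ ⇔ (y₂ ≈ y₁ ⊎ y₂ ≈ 1# - y₁))

  excluded : ℕ → ℕ → Carrier
  excluded k n = fromℤ (+ k ℤ.* (+ n ℤ.- + 1) ℤ.+ + 2) / pow two n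

  AvoidsExcluded : ℕ → ℕ → ℕ → Set
  AvoidsExcluded q k n = ∀ y → InS q y → ¬ (g k n y ≈ excluded k n)

{-# OPTIONS --safe #-}
module Submission where

-- Put x = y(1 - y), u = y, v = 1 - y and hₙ = Σ_{i+j=n} uⁱvʲ. Both
-- D_{n,1}(1, x) = Σ C(n-i, i)(-x)ⁱ and hₙ satisfy a_{n+2} = a_{n+1} - x aₙ with the
-- same start, so they agree; splitting the coefficients of D_{n,k} then gives
-- g(y) = hₙ - (1 - k) x hₙ₋₂ = D_{n,k}(1, x) whenever y ≠ 1/2. The map y ↦ y(1 - y)
-- sends S onto F_q ∖ {1/4}, identifying exactly y and 1 - y: the roots
-- (1 ± √(1 - 4x))/2 lie in F_q or in V because every element of F_q is a square
-- in F_{q²}. The remaining point 1/4 = y(1 - y) at y = 1/2 has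
-- D_{n,k}(1, 1/4) = (k(n-1)+2)/2ⁿ. So D_{n,k} is injective on F_q iff g is 2-to-1 on S
-- and misses that value, and an injective self-map of the finite set F_q is bijective.

open import Level using (0ℓ)
open import Data.Nat as ℕ using (ℕ; zero; suc; _∸_)
import Data.Nat.Properties as ℕ
import Data.Nat.Tactic.RingSolver as ℕ-Solver
open import Data.Integer as ℤ using (ℤ; +_; -[1+_])
import Data.Integer.Properties as ℤ
open import Data.Product using (Σ; ∃; _×_; _,_; proj₁; proj₂)
open import Data.Sum using (_⊎_; inj₁; inj₂)
open import Data.Maybe using (Maybe; just; nothing)
open import Data.Empty using (⊥; ⊥-elim)
open import Relation.Nullary using (Dec; yes; no)
open import Relation.Binary.PropositionalEquality as ≡ using (_≡_)
import Algebra.Solver.Ring.AlmostCommutativeRing as ACR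
import Algebra.Solver.Ring
import Algebra.Properties.Group as GroupProperties
import Algebra.Properties.Ring as RingProperties
import Algebra.Properties.AbelianGroup as AbelianGroupProperties
import Algebra.Properties.CommutativeSemigroup as CommutativeSemigroupProperties
import Algebra.Properties.Semiring.Exp as ExpProperties
import Algebra.Properties.CommutativeSemiring.Exp as CommExpProperties
import Algebra.Properties.Semiring.Mult as MultProperties
import Algebra.Properties.Monoid.Mult as MonoidMultProperties
import Algebra.Properties.CommutativeMonoid.Sum as SumProperties
open import Data.Fin as Fin using (Fin; toℕ)
open import Data.Fin.Properties using (toℕ-fromℕ)
open import Data.Nat.Combinatorics using (_C_; nCn≡1)
open import Data.Nat.DivMod using (_%_; m/n≤m)
open import Data.Nat.Divisibility using (_∣_; divides)
open import Data.Nat.Primality using (Prime)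
import Algebra.Properties.CommutativeSemiring.Binomial as BinomialProperties
open import Data.Fin.Permutation using (Permutation; permutation)
open import Data.List using (List; []; _∷_; length; foldr; filter; tabulate; map)
import Data.List.Properties as List
open import Data.List.Relation.Unary.Any as Any using (Any; here; there; any?)
open import Data.List.Relation.Unary.AllPairs using ([]; _∷_)
import Data.List.Membership.Setoid as Membership
import Data.List.Membership.Setoid.Properties as MembershipProperties
import Data.List.Relation.Unary.Unique.Setoid as Unique
import Data.List.Relation.Unary.Unique.Setoid.Properties as UniqueProperties
open import Relation.Nullary using (¬?)
open import Relation.Binary using (_Respects_)
open import Relation.Unary using (Decidable)
open import Relation.Nullary.Decidable using (_×-dec_)
import Data.List.Relation.Unary.All as All
import Data.List.Relation.Unary.All.Properties as All
open import Function.Bundles using (Bijection; _⇔_; mk⇔; Equivalence)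
open import Defs

module Arithmetic where
  open import Data.Nat
  open import Data.Nat.Properties
  open import Data.Nat.Combinatorics using (nCk+nC[k+1]≡[n+1]C[k+1]; k>n⇒nCk≡0; nC1≡n)
  open import Data.Nat.DivMod using (_/_; m≡m%n+[m/n]*n; m%n<n; m/n<m; m/n≡1+[m∸n]/n; m*n/n≡m; m*n%n≡0)
  open import Data.Nat.Divisibility using (m∣m*n; ∣⇒≤)
  open import Data.Nat.Primality using (euclidsLemma)
  open import Data.Integer.DivMod using (_/ℕ_)
  import Data.Integer.Tactic.RingSolver as ℤ-Solver
  open import Relation.Binary.PropositionalEquality

  [1+k]*[1+n]C[1+k]≡[1+n]*nCk : ∀ n k → suc k * (suc n C suc k) ≡ suc n * (n C k)
  [1+k]*[1+n]C[1+k]≡[1+n]*nCk zero zero = refl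
  [1+k]*[1+n]C[1+k]≡[1+n]*nCk zero (suc k)
    rewrite k>n⇒nCk≡0 {1} {suc (suc k)} (s≤s (s≤s z≤n))
          | k>n⇒nCk≡0 {0} {suc k} (s≤s z≤n) = *-zeroʳ k
  [1+k]*[1+n]C[1+k]≡[1+n]*nCk (suc n) zero = trans (*-identityˡ _) (trans (nC1≡n (suc (suc n))) (sym (*-identityʳ _)))
  [1+k]*[1+n]C[1+k]≡[1+n]*nCk (suc n) (suc k) = begin
    suc (suc k) * (suc (suc n) C suc (suc k))
      ≡⟨ cong (suc (suc k) *_) (sym (nCk+nC[k+1]≡[n+1]C[k+1] (suc n) (suc k))) ⟩
    suc (suc k) * (A + B)
      ≡⟨ split k A B ⟩
    suc k * A + A + suc (suc k) * B
      ≡⟨ cong₂ (λ a b → a + A + b) ([1+k]*[1+n]C[1+k]≡[1+n]*nCk n k) ([1+k]*[1+n]C[1+k]≡[1+n]*nCk n (suc k)) ⟩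
    suc n * (n C k) + A + suc n * (n C suc k)
      ≡⟨ merge n (n C k) A (n C suc k) ⟩
    A + suc n * (n C k + n C suc k)
      ≡⟨ cong (λ z → A + suc n * z) (nCk+nC[k+1]≡[n+1]C[k+1] n k) ⟩
    suc (suc n) * A ∎
    where
    open ≡-Reasoning
    split : ∀ k a b → suc (suc k) * (a + b) ≡ suc k * a + a + suc (suc k) * b
    split = ℕ-Solver.solve-∀
    merge : ∀ n x a y → suc n * x + a + suc n * y ≡ a + suc n * (x + y)
    merge = ℕ-Solver.solve-∀
    A = suc n C suc k
    B = suc n C suc (suc k)

  prime∣pC[1+j] : ∀ {p j} → Prime (suc p) → j < p → suc p ∣ suc p C suc j
  prime∣pC[1+j] {p} {j} p-prime j<p
    with euclidsLemma (suc j) (suc p C suc j) p-prime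
           (subst (suc p ∣_) (sym ([1+k]*[1+n]C[1+k]≡[1+n]*nCk p j)) (m∣m*n (p C j)))
  ... | inj₁ p∣1+j = ⊥-elim (<-irrefl refl (≤-trans (s≤s j<p) (∣⇒≤ p∣1+j)))
  ... | inj₂ p∣C = p∣C

  odd⇒1+2* : ∀ p → p % 2 ≡ 1 → Σ ℕ λ r → p ≡ suc (r + r)
  odd⇒1+2* p p%2≡1 = p / 2 , trans (m≡m%n+[m/n]*n p 2) (cong₂ _+_ p%2≡1 (trans (*-comm (p / 2) 2) (cong (_+_ (p / 2)) (+-identityʳ (p / 2)))))

  odd-^ : ∀ {p} r → p ≡ suc (r + r) → ∀ e → Σ ℕ λ s → p ^ e ≡ suc (s + s)
  odd-^ r p≡ zero = 0 , refl
  odd-^ r p≡ (suc e) with odd-^ r p≡ e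
  ... | s , q≡ = r + s + 2 * r * s , trans (cong₂ _*_ p≡ q≡) (odd-* r s)
    where
    odd-* : ∀ a b → suc (a + a) * suc (b + b) ≡ suc ((a + b + 2 * a * b) + (a + b + 2 * a * b))
    odd-* = ℕ-Solver.solve-∀

  *-/ℕ-cancel : ∀ a d → (a ℤ.* + suc d) /ℕ suc d ≡ a
  *-/ℕ-cancel (+ n) d rewrite ℤ.+◃n≡+n (n * suc d) = cong +_ (m*n/n≡m n (suc d))
  *-/ℕ-cancel -[1+ n ] d with suc (d + n * suc d) % suc d in eq
  ... | zero = cong (λ z → ℤ.- (+ z)) (m*n/n≡m (suc n) (suc d))
  ... | suc r with () ← trans (sym eq) (m*n%n≡0 (suc n) (suc d))

  -- C(n-1-i, i-1) for i ≥ 1: the coefficient of tⁱ in t·E_{n-2}(t) below.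
  shiftedC : ℕ → ℕ → ℕ
  shiftedC n zero    = 0
  shiftedC n (suc j) = ((n ∸ 2) ∸ j) C j

  i*[1+m]Ci≡[1+m]*shiftedC : ∀ n i {m} → n ∸ i ≡ suc m → i * (suc m C i) ≡ suc m * shiftedC n i
  i*[1+m]Ci≡[1+m]*shiftedC n zero {m} _ = sym (*-zeroʳ (suc m))
  i*[1+m]Ci≡[1+m]*shiftedC (suc (suc n)) (suc j) {m} n∸i≡ = begin
    suc j * (suc m C suc j)  ≡⟨ [1+k]*[1+n]C[1+k]≡[1+n]*nCk m j ⟩
    suc m * (m C j)          ≡⟨ cong (λ z → suc m * (z C j)) m≡ ⟩
    suc m * ((n ∸ j) C j)    ∎
    where
    open ≡-Reasoning
    m≡ : m ≡ n ∸ j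
    m≡ = trans (cong pred (sym n∸i≡)) (pred[m∸n]≡m∸[1+n] (suc n) j)
  i*[1+m]Ci≡[1+m]*shiftedC (suc zero) (suc zero) ()
  i*[1+m]Ci≡[1+m]*shiftedC (suc zero) (suc (suc _)) ()
  i*[1+m]Ci≡[1+m]*shiftedC zero (suc _) ()

  ∸≡suc⇒≡+ : ∀ n i {m} → n ∸ i ≡ suc m → n ≡ i + suc m
  ∸≡suc⇒≡+ n zero eq = eq
  ∸≡suc⇒≡+ (suc n) (suc i) eq = cong suc (∸≡suc⇒≡+ n i eq)
  ∸≡suc⇒≡+ zero (suc i) ()

  -- Splitting n - k i = (n - i) + (1 - k) i makes the division by n - i exact.
  coef≡C+[1-k]*shiftedC : ∀ n k i {m} → n ∸ i ≡ suc m →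
    coef n k i ≡ + ((n ∸ i) C i) ℤ.+ (+ 1 ℤ.- + k) ℤ.* + shiftedC n i
  coef≡C+[1-k]*shiftedC n k i {m} n∸i≡ with n ∸ i in eq
  coef≡C+[1-k]*shiftedC n k i {m} refl | .(suc m) = begin
    ((+ n ℤ.- + k ℤ.* + i) ℤ.* + ((n ∸ i) C i)) /ℕ suc m
      ≡⟨ cong (λ z → ((+ n ℤ.- + k ℤ.* + i) ℤ.* + (z C i)) /ℕ suc m) eq ⟩
    ((+ n ℤ.- + k ℤ.* + i) ℤ.* + c) /ℕ suc m
      ≡⟨ cong (λ z → ((z ℤ.- + k ℤ.* + i) ℤ.* + c) /ℕ suc m) n≡ ⟩
    ((+ i ℤ.+ + suc m ℤ.- + k ℤ.* + i) ℤ.* + c) /ℕ suc m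
      ≡⟨ cong (_/ℕ suc m) (regroup (+ i) (+ suc m) (+ k) (+ c)) ⟩
    (+ suc m ℤ.* + c ℤ.+ (+ 1 ℤ.- + k) ℤ.* (+ i ℤ.* + c)) /ℕ suc m
      ≡⟨ cong (λ z → (+ suc m ℤ.* + c ℤ.+ (+ 1 ℤ.- + k) ℤ.* z) /ℕ suc m) absorbed ⟩
    (+ suc m ℤ.* + c ℤ.+ (+ 1 ℤ.- + k) ℤ.* (+ suc m ℤ.* + c′)) /ℕ suc m
      ≡⟨ cong (_/ℕ suc m) (factor (+ suc m) (+ k) (+ c) (+ c′)) ⟩
    ((+ c ℤ.+ (+ 1 ℤ.- + k) ℤ.* + c′) ℤ.* + suc m) /ℕ suc m
      ≡⟨ *-/ℕ-cancel _ m ⟩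
    + c ℤ.+ (+ 1 ℤ.- + k) ℤ.* + c′ ∎
    where
    open ≡-Reasoning
    c  = suc m C i
    c′ = shiftedC n i
    n≡ : + n ≡ + i ℤ.+ + suc m
    n≡ = trans (cong +_ (∸≡suc⇒≡+ n i eq)) (ℤ.pos-+ i (suc m))
    regroup : ∀ i s k c → (i ℤ.+ s ℤ.- k ℤ.* i) ℤ.* c ≡ s ℤ.* c ℤ.+ (+ 1 ℤ.- k) ℤ.* (i ℤ.* c)
    regroup = ℤ-Solver.solve-∀
    factor : ∀ s k c c′ → s ℤ.* c ℤ.+ (+ 1 ℤ.- k) ℤ.* (s ℤ.* c′) ≡ (c ℤ.+ (+ 1 ℤ.- k) ℤ.* c′) ℤ.* s
    factor = ℤ-Solver.solve-∀
    absorbed : + i ℤ.* + c ≡ + suc m ℤ.* + c′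
    absorbed = trans (sym (ℤ.pos-* i c)) (trans (cong +_ (i*[1+m]Ci≡[1+m]*shiftedC n i eq)) (ℤ.pos-* (suc m) c′))

  [1+n∸j]C[1+j]≡[n∸j]Cj+[n∸j]C[1+j] : ∀ n j → (suc n ∸ j) C suc j ≡ (n ∸ j) C j + (n ∸ j) C suc j
  [1+n∸j]C[1+j]≡[n∸j]Cj+[n∸j]C[1+j] n j with j ≤? n
  ... | yes j≤n rewrite +-∸-assoc 1 j≤n = sym (nCk+nC[k+1]≡[n+1]C[k+1] (n ∸ j) j)
  [1+n∸j]C[1+j]≡[n∸j]Cj+[n∸j]C[1+j] n (suc j) | no j≰n
    rewrite m≤n⇒m∸n≡0 (s≤s⁻¹ (≰⇒> j≰n)) | m≤n⇒m∸n≡0 (m≤n⇒m≤1+n (s≤s⁻¹ (≰⇒> j≰n))) = refl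
  [1+n∸j]C[1+j]≡[n∸j]Cj+[n∸j]C[1+j] n zero | no 0≰n = ⊥-elim (0≰n z≤n)

  ∸C-vanish : ∀ n j → n < suc j + suc j → (n ∸ suc j) C suc j ≡ 0
  ∸C-vanish n j lt = k>n⇒nCk≡0 (m<n+o⇒m∸n<o n (suc j) lt)

  n<[1+n/2]+[1+n/2] : ∀ n → n < suc (n / 2) + suc (n / 2)
  n<[1+n/2]+[1+n/2] n = begin-strict
    n                    ≡⟨ m≡m%n+[m/n]*n n 2 ⟩
    n % 2 + n / 2 * 2    <⟨ +-monoˡ-< (n / 2 * 2) (m%n<n n 2) ⟩
    2 + n / 2 * 2        ≡⟨ twice (n / 2) ⟩
    suc (n / 2) + suc (n / 2) ∎
    where
    open ≤-Reasoning
    twice : ∀ h → 2 + h * 2 ≡ suc h + suc h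
    twice = ℕ-Solver.solve-∀

  [2+n]/2≡1+n/2 : ∀ n → suc (suc n) / 2 ≡ suc (n / 2)
  [2+n]/2≡1+n/2 n = m/n≡1+[m∸n]/n {suc (suc n)} {2} (s≤s (s≤s z≤n))

  ≤[1+n]/2⇒[1+n]∸i≡suc : ∀ n i → i ≤ suc n / 2 → suc n ∸ i ≡ suc (n ∸ i)
  ≤[1+n]/2⇒[1+n]∸i≡suc n i i≤ = +-∸-assoc 1 (≤-trans i≤ (s≤s⁻¹ (m/n<m (suc n) 2 (s≤s (s≤s z≤n)))))

  m+m≡n+n⇒m≡n : ∀ m n → m + m ≡ n + n → m ≡ n
  m+m≡n+n⇒m≡n m n eq = *-cancelˡ-≡ m n 2 (trans (cong (_+_ m) (+-identityʳ m)) (trans eq (sym (cong (_+_ n) (+-identityʳ n)))))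

open Arithmetic

module _ {m : ℕ} (F : FieldOfOrder m) where
  open FieldOfOrder F hiding (zero)
  open FF F
  open import Relation.Binary.Reasoning.Setoid setoid
  open GroupProperties +-group using (x∙y⁻¹≈ε⇒x≈y; x≈y⇒x∙y⁻¹≈ε) renaming (identityʳ-unique to +-identityʳ-unique; ε⁻¹≈ε to -0≈0; ⁻¹-involutive to -‿involutive)
  open RingProperties ring using (-‿distribˡ-*; -‿distribʳ-*)
  open AbelianGroupProperties +-abelianGroup using (⁻¹-∙-comm)
  open CommutativeSemigroupProperties +-commutativeSemigroup using (interchange)
  open CommutativeSemigroupProperties *-commutativeSemigroup using (x∙yz≈y∙xz)
  open ExpProperties semiring using (_^_; ^-assocʳ)
  open CommExpProperties commutativeSemiring using (^-distrib-*)
  open BinomialProperties commutativeSemiring using (binomialTerm) renaming (theorem to binomial-theorem)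
  open MultProperties semiring using (×1-homo-*) renaming (_×_ to _·_)
  open MonoidMultProperties +-monoid using (×-homo-+)
  open import Algebra.Definitions.RawMonoid +-rawMonoid using (sum)
  open SumProperties +-commutativeMonoid using (sum-permute; ∑-distrib-+; sum-cong-≋)

  pow≡^ : ∀ x n → pow x n ≡ x ^ n
  pow≡^ x zero    = ≡.refl
  pow≡^ x (suc n) = ≡.cong (x *_) (pow≡^ x n)

  fromℕ≡·1 : ∀ n → fromℕ n ≡ n · 1#
  fromℕ≡·1 zero    = ≡.refl
  fromℕ≡·1 (suc n) = ≡.cong (_+_ 1#) (fromℕ≡·1 n)

  fromℕ-+ : ∀ a b → fromℕ (a ℕ.+ b) ≈ fromℕ a + fromℕ b
  fromℕ-+ a b rewrite fromℕ≡·1 (a ℕ.+ b) | fromℕ≡·1 a | fromℕ≡·1 b = ×-homo-+ 1# a b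

  fromℕ-* : ∀ a b → fromℕ (a ℕ.* b) ≈ fromℕ a * fromℕ b
  fromℕ-* a b rewrite fromℕ≡·1 (a ℕ.* b) | fromℕ≡·1 a | fromℕ≡·1 b = ×1-homo-* a b

  ·≈fromℕ* : ∀ n z → n · z ≈ fromℕ n * z
  ·≈fromℕ* zero    z = sym (zeroˡ z)
  ·≈fromℕ* (suc n) z = begin
    z + n · z               ≈⟨ +-cong (sym (*-identityˡ z)) (·≈fromℕ* n z) ⟩
    1# * z + fromℕ n * z    ≈⟨ distribʳ _ _ _ ⟨
    (1# + fromℕ n) * z      ∎

  fromℤ-⊖ : ∀ a b → fromℤ (a ℤ.⊖ b) ≈ fromℕ a - fromℕ b
  fromℤ-⊖ a zero = begin
    fromℕ a        ≈⟨ +-identityʳ _ ⟨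
    fromℕ a + 0#   ≈⟨ +-congˡ -0≈0 ⟨
    fromℕ a - 0#   ∎
  fromℤ-⊖ zero (suc b) = sym (+-identityˡ _)
  fromℤ-⊖ (suc a) (suc b) = begin
    fromℤ (suc a ℤ.⊖ suc b)      ≡⟨ ≡.cong fromℤ (ℤ.[1+m]⊖[1+n]≡m⊖n a b) ⟩
    fromℤ (a ℤ.⊖ b)              ≈⟨ fromℤ-⊖ a b ⟩
    fromℕ a - fromℕ b                   ≈⟨ +-identityˡ _ ⟨
    0# + (fromℕ a - fromℕ b)            ≈⟨ +-congʳ (-‿inverseʳ 1#) ⟨
    (1# - 1#) + (fromℕ a - fromℕ b)     ≈⟨ interchange 1# (- 1#) (fromℕ a) (- fromℕ b) ⟩
    (1# + fromℕ a) + (- 1# - fromℕ b)   ≈⟨ +-congˡ (⁻¹-∙-comm 1# (fromℕ b)) ⟩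
    (1# + fromℕ a) - (1# + fromℕ b)     ∎

  fromℤ-neg : ∀ i → fromℤ (ℤ.- i) ≈ - fromℤ i
  fromℤ-neg (+ zero)  = sym -0≈0
  fromℤ-neg (+ suc n) = refl
  fromℤ-neg -[1+ n ]  = sym (-‿involutive _)

  fromℤ-+ : ∀ i j → fromℤ (i ℤ.+ j) ≈ fromℤ i + fromℤ j
  fromℤ-+ (+ a)    (+ b)    = fromℕ-+ a b
  fromℤ-+ (+ a)    -[1+ b ] = fromℤ-⊖ a (suc b)
  fromℤ-+ -[1+ a ] (+ b)    = trans (fromℤ-⊖ b (suc a)) (+-comm _ _)
  fromℤ-+ -[1+ a ] -[1+ b ] = begin
    - fromℕ (suc (suc (a ℕ.+ b)))       ≡⟨ ≡.cong (λ z → - fromℕ (suc z)) (ℕ.+-suc a b) ⟨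
    - fromℕ (suc a ℕ.+ suc b)           ≈⟨ -‿cong (fromℕ-+ (suc a) (suc b)) ⟩
    - (fromℕ (suc a) + fromℕ (suc b))   ≈⟨ ⁻¹-∙-comm _ _ ⟨
    - fromℕ (suc a) - fromℕ (suc b)     ∎

  fromℤ-* : ∀ i j → fromℤ (i ℤ.* j) ≈ fromℤ i * fromℤ j
  fromℤ-* (+ a) (+ b) rewrite ℤ.+◃n≡+n (a ℕ.* b) = fromℕ-* a b
  fromℤ-* (+ a) -[1+ b ] rewrite ℤ.-◃n≡-n (a ℕ.* suc b) = begin
    fromℤ (ℤ.- (+ (a ℕ.* suc b)))       ≈⟨ fromℤ-neg (+ (a ℕ.* suc b)) ⟩
    - fromℕ (a ℕ.* suc b)               ≈⟨ -‿cong (fromℕ-* a (suc b)) ⟩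
    - (fromℕ a * fromℕ (suc b))         ≈⟨ -‿distribʳ-* _ _ ⟩
    fromℕ a * - fromℕ (suc b)           ∎
  fromℤ-* -[1+ a ] (+ b) rewrite ℤ.-◃n≡-n (suc a ℕ.* b) = begin
    fromℤ (ℤ.- (+ (suc a ℕ.* b)))       ≈⟨ fromℤ-neg (+ (suc a ℕ.* b)) ⟩
    - fromℕ (suc a ℕ.* b)               ≈⟨ -‿cong (fromℕ-* (suc a) b) ⟩
    - (fromℕ (suc a) * fromℕ b)         ≈⟨ -‿distribˡ-* _ _ ⟩
    - fromℕ (suc a) * fromℕ b           ∎
  fromℤ-* -[1+ a ] -[1+ b ] rewrite ℤ.+◃n≡+n (suc a ℕ.* suc b) = begin
    fromℕ (suc a ℕ.* suc b)                 ≈⟨ fromℕ-* (suc a) (suc b) ⟩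
    fromℕ (suc a) * fromℕ (suc b)           ≈⟨ -‿involutive _ ⟨
    - - (fromℕ (suc a) * fromℕ (suc b))     ≈⟨ -‿cong (-‿distribˡ-* _ _) ⟩
    - (- fromℕ (suc a) * fromℕ (suc b))     ≈⟨ -‿distribʳ-* _ _ ⟩
    - fromℕ (suc a) * - fromℕ (suc b)       ∎

  fromℤ-sub : ∀ i j → fromℤ (i ℤ.- j) ≈ fromℤ i - fromℤ j
  fromℤ-sub i j = trans (fromℤ-+ i (ℤ.- j)) (+-congˡ (fromℤ-neg j))

  -- A variant of fromℤ sending 1 to 1# (rather than 1# + 0#) and 2 to 1# + 1#,
  -- so that solver constants unfold to the expected field elements.
  ⟦_⟧ℕ : ℕ → Carrier
  ⟦ 0 ⟧ℕ           = 0#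
  ⟦ 1 ⟧ℕ           = 1#
  ⟦ suc (suc n) ⟧ℕ = 1# + ⟦ suc n ⟧ℕ

  ⟦_⟧ℤ : ℤ → Carrier
  ⟦ + n ⟧ℤ     = ⟦ n ⟧ℕ
  ⟦ -[1+ n ] ⟧ℤ = - ⟦ suc n ⟧ℕ

  ⟦⟧ℕ≈fromℕ : ∀ n → ⟦ n ⟧ℕ ≈ fromℕ n
  ⟦⟧ℕ≈fromℕ 0           = refl
  ⟦⟧ℕ≈fromℕ 1           = sym (+-identityʳ 1#)
  ⟦⟧ℕ≈fromℕ (suc (suc n)) = +-congˡ (⟦⟧ℕ≈fromℕ (suc n))

  ⟦⟧ℤ≈fromℤ : ∀ i → ⟦ i ⟧ℤ ≈ fromℤ i
  ⟦⟧ℤ≈fromℤ (+ n)     = ⟦⟧ℕ≈fromℕ n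
  ⟦⟧ℤ≈fromℤ -[1+ n ] = -‿cong (⟦⟧ℕ≈fromℕ (suc n))

  private
    almostCommutativeRing : ACR.AlmostCommutativeRing 0ℓ 0ℓ
    almostCommutativeRing = ACR.fromCommutativeRing commRing

    ℤ-morphism : ℤ.+-*-rawRing ACR.-Raw-AlmostCommutative⟶ almostCommutativeRing
    ℤ-morphism = record
      { ⟦_⟧    = ⟦_⟧ℤ
      ; +-homo = λ i j → homo (i ℤ.+ j) (fromℤ-+ i j) (+-cong (⟦⟧ℤ≈fromℤ i) (⟦⟧ℤ≈fromℤ j))
      ; *-homo = λ i j → homo (i ℤ.* j) (fromℤ-* i j) (*-cong (⟦⟧ℤ≈fromℤ i) (⟦⟧ℤ≈fromℤ j))
      ; -‿homo = λ i → homo (ℤ.- i) (fromℤ-neg i) (-‿cong (⟦⟧ℤ≈fromℤ i))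
      ; 0-homo = refl
      ; 1-homo = refl
      }
      where
      homo : ∀ i {x y} → fromℤ i ≈ x → y ≈ x → ⟦ i ⟧ℤ ≈ y
      homo i i≈x y≈x = trans (⟦⟧ℤ≈fromℤ i) (trans i≈x (sym y≈x))

    ℤ-equal? : ∀ i j → Maybe (⟦ i ⟧ℤ ≈ ⟦ j ⟧ℤ)
    ℤ-equal? i j with i ℤ.≟ j
    ... | yes ≡.refl = just refl
    ... | no _       = nothing

  module Solver = Algebra.Solver.Ring ℤ.+-*-rawRing almostCommutativeRing ℤ-morphism ℤ-equal?
  open Solver using (solve)
    renaming (_:+_ to _⊕_; _:*_ to _⊗_; _:-_ to _⊖_; :-_ to ⊝_; _:=_ to _⊜_; con to κ)

  1≉0 : 1# ≉ 0#
  1≉0 1≈0 = 0≉1 (sym 1≈0)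

  inverseˡ : ∀ x → x ≉ 0# → x ⁻¹ * x ≈ 1#
  inverseˡ x x≉0 = trans (*-comm _ _) (inverseʳ x x≉0)

  *-cancelˡ : ∀ x {a b} → x ≉ 0# → x * a ≈ x * b → a ≈ b
  *-cancelˡ x {a} {b} x≉0 xa≈xb = begin
    a                ≈⟨ *-identityˡ a ⟨
    1# * a           ≈⟨ *-congʳ (inverseˡ x x≉0) ⟨
    (x ⁻¹ * x) * a   ≈⟨ *-assoc _ _ _ ⟩
    x ⁻¹ * (x * a)   ≈⟨ *-congˡ xa≈xb ⟩
    x ⁻¹ * (x * b)   ≈⟨ *-assoc _ _ _ ⟨
    (x ⁻¹ * x) * b   ≈⟨ *-congʳ (inverseˡ x x≉0) ⟩
    1# * b           ≈⟨ *-identityˡ b ⟩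
    b                ∎

  x*y≈1⇒x≉0 : ∀ {x y} → x * y ≈ 1# → x ≉ 0#
  x*y≈1⇒x≉0 {x} {y} xy≈1 x≈0 = 0≉1 (trans (sym (trans (*-congʳ x≈0) (zeroˡ y))) xy≈1)

  ⁻¹-unique : ∀ {x y} → x * y ≈ 1# → y ≈ x ⁻¹
  ⁻¹-unique {x} {y} xy≈1 = *-cancelˡ x (x*y≈1⇒x≉0 xy≈1) (trans xy≈1 (sym (inverseʳ x (x*y≈1⇒x≉0 xy≈1))))

  ⁻¹-cong : ∀ {x y} → x ≈ y → x ≉ 0# → x ⁻¹ ≈ y ⁻¹
  ⁻¹-cong {x} x≈y x≉0 = ⁻¹-unique (trans (*-congʳ (sym x≈y)) (inverseʳ x x≉0))

  ⁻¹-≉0 : ∀ {x} → x ≉ 0# → x ⁻¹ ≉ 0#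
  ⁻¹-≉0 {x} x≉0 = x*y≈1⇒x≉0 (inverseˡ x x≉0)

  ⁻¹-involutive : ∀ {x} → x ≉ 0# → (x ⁻¹) ⁻¹ ≈ x
  ⁻¹-involutive {x} x≉0 = sym (⁻¹-unique (inverseˡ x x≉0))

  x*y≈0⇒x≈0⊎y≈0 : ∀ {x y} → x * y ≈ 0# → x ≈ 0# ⊎ y ≈ 0#
  x*y≈0⇒x≈0⊎y≈0 {x} {y} xy≈0 with x ≟ 0#
  ... | yes x≈0 = inj₁ x≈0
  ... | no x≉0  = inj₂ (*-cancelˡ x x≉0 (trans xy≈0 (sym (zeroʳ x))))

  *-≉0 : ∀ {x y} → x ≉ 0# → y ≉ 0# → x * y ≉ 0#
  *-≉0 x≉0 y≉0 xy≈0 with x*y≈0⇒x≈0⊎y≈0 xy≈0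
  ... | inj₁ x≈0 = x≉0 x≈0
  ... | inj₂ y≈0 = y≉0 y≈0

  pow-cong : ∀ {x y} n → x ≈ y → pow x n ≈ pow y n
  pow-cong zero    x≈y = refl
  pow-cong (suc n) x≈y = *-cong x≈y (pow-cong n x≈y)

  pow-* : ∀ x a b → pow x (a ℕ.* b) ≈ pow (pow x a) b
  pow-* x a b rewrite pow≡^ x (a ℕ.* b) | pow≡^ (pow x a) b | pow≡^ x a = sym (^-assocʳ x a b)

  pow-distrib-* : ∀ x y n → pow (x * y) n ≈ pow x n * pow y n
  pow-distrib-* x y n rewrite pow≡^ (x * y) n | pow≡^ x n | pow≡^ y n = ^-distrib-* x y n

  pow-1 : ∀ n → pow 1# n ≈ 1#
  pow-1 zero    = refl
  pow-1 (suc n) = trans (*-identityˡ _) (pow-1 n)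

  pow-≉0 : ∀ {x} n → x ≉ 0# → pow x n ≉ 0#
  pow-≉0 zero    x≉0 = 1≉0
  pow-≉0 (suc n) x≉0 = *-≉0 x≉0 (pow-≉0 n x≉0)

  pow-⁻¹ : ∀ {x} n → x ≉ 0# → pow (x ⁻¹) n ≈ pow x n ⁻¹
  pow-⁻¹ {x} n x≉0 = ⁻¹-unique (trans (sym (pow-distrib-* x (x ⁻¹) n)) (trans (pow-cong n (inverseʳ x x≉0)) (pow-1 n)))

  fromℕ-^ : ∀ a n → fromℕ (a ℕ.^ n) ≈ pow (fromℕ a) n
  fromℕ-^ a zero    = +-identityʳ 1#
  fromℕ-^ a (suc n) = trans (fromℕ-* a (a ℕ.^ n)) (*-congˡ (fromℕ-^ a n))

  open Membership setoid using (_∈_; _∉_)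
  open Unique setoid using (Unique)

  ∈-resp-≈ : ∀ {L} → (_∈ L) Respects _≈_
  ∈-resp-≈ = MembershipProperties.∈-resp-≈ setoid

  remove : Carrier → List Carrier → List Carrier
  remove y = filter (λ z → ¬? (y ≟ z))

  private
    ≉-resp : ∀ {y} → (y ≉_) Respects _≈_
    ≉-resp z≈w y≉z y≈w = y≉z (trans y≈w (sym z≈w))

  ∈-remove⁺ : ∀ {y z L} → z ∈ L → y ≉ z → z ∈ remove y L
  ∈-remove⁺ = MembershipProperties.∈-filter⁺ setoid (λ z → ¬? (_ ≟ z)) ≉-resp

  ∈-remove⁻ : ∀ {y z L} → z ∈ remove y L → z ∈ L × y ≉ z
  ∈-remove⁻ = MembershipProperties.∈-filter⁻ setoid (λ z → ¬? (_ ≟ z)) ≉-resp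

  remove-unique : ∀ {L} y → Unique L → Unique (remove y L)
  remove-unique y = UniqueProperties.filter⁺ setoid (λ z → ¬? (y ≟ z))

  remove-∉ : ∀ {y} L → y ∉ L → remove y L ≡ L
  remove-∉ {y} [] _ = ≡.refl
  remove-∉ {y} (z ∷ L) y∉ with y ≟ z
  ... | yes y≈z = ⊥-elim (y∉ (here y≈z))
  ... | no _    = ≡.cong (z ∷_) (remove-∉ L (λ y∈L → y∉ (there y∈L)))

  length-remove : ∀ {y L} → y ∈ L → Unique L → length L ≡ suc (length (remove y L))
  length-remove {y} {z ∷ L} y∈ (z∉L ∷ uL) with y ≟ z | y∈
  ... | yes y≈z | _        = ≡.cong suc (≡.cong length (≡.sym (remove-∉ L (λ y∈L → MembershipProperties.All[≉]⇒∉ setoid z∉L (∈-resp-≈ y≈z y∈L)))))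
  ... | no y≉z  | here y≈z = ⊥-elim (y≉z y≈z)
  ... | no _    | there y∈L = ≡.cong suc (length-remove y∈L uL)

  prod : List Carrier → Carrier
  prod = foldr _*_ 1#

  prod-remove : ∀ {y L} → y ∈ L → Unique L → prod L ≈ y * prod (remove y L)
  prod-remove {y} {z ∷ L} y∈ (z∉L ∷ uL) with y ≟ z | y∈
  ... | yes y≈z | _        = *-cong (sym y≈z) (reflexive (≡.cong prod (≡.sym (remove-∉ L (λ y∈L → MembershipProperties.All[≉]⇒∉ setoid z∉L (∈-resp-≈ y≈z y∈L))))))
  ... | no y≉z  | here y≈z = ⊥-elim (y≉z y≈z)
  ... | no _    | there y∈L = begin
    z * prod L                      ≈⟨ *-congˡ (prod-remove y∈L uL) ⟩
    z * (y * prod (remove y L))     ≈⟨ x∙yz≈y∙xz z y _ ⟩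
    y * (z * prod (remove y L))     ∎

  ⊆⇒length≤ : ∀ {A B} → Unique A → Unique B → (∀ {z} → z ∈ A → z ∈ B) → length A ℕ.≤ length B
  ⊆⇒length≤ {[]}    _           _  _   = ℕ.z≤n
  ⊆⇒length≤ {a ∷ A} {B} (a∉A ∷ uA) uB A⊆B = ℕ.≤-trans
    (ℕ.s≤s (⊆⇒length≤ uA (remove-unique a uB) A⊆B∖a))
    (ℕ.≤-reflexive (≡.sym (length-remove (A⊆B (here refl)) uB)))
    where
    A⊆B∖a : ∀ {z} → z ∈ A → z ∈ remove a B
    A⊆B∖a z∈A = ∈-remove⁺ (A⊆B (there z∈A)) (λ a≈z → MembershipProperties.All[≉]⇒∉ setoid a∉A (∈-resp-≈ (sym a≈z) z∈A))

  record Pairing (L : List Carrier) (c : Carrier) : Set where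
    field
      partner             : Carrier → Carrier
      partner-cong        : ∀ {z w} → z ∈ L → z ≈ w → partner z ≈ partner w
      partner-∈           : ∀ {z} → z ∈ L → partner z ∈ L
      partner-≉           : ∀ {z} → z ∈ L → partner z ≉ z
      partner-involutive  : ∀ {z} → z ∈ L → partner (partner z) ≈ z
      *-partner           : ∀ {z} → z ∈ L → z * partner z ≈ c

  Pairing⇒prod≈pow : ∀ {L c} → Unique L → Pairing L c → Σ ℕ λ k → length L ≡ k ℕ.+ k × prod L ≈ pow c k
  Pairing⇒prod≈pow {L} = go (length L) ≡.refl
    where
    go : ∀ n {L c} → length L ≡ n → Unique L → Pairing L c → Σ ℕ λ k → n ≡ k ℕ.+ k × prod L ≈ pow c k
    go _ {[]} ≡.refl _ _ = 0 , ≡.refl , refl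
    go (suc zero) {x ∷ []} _ _ P with Pairing.partner-∈ P (here refl)
    ... | here σx≈x = ⊥-elim (Pairing.partner-≉ P (here refl) σx≈x)
    go (suc (suc n)) {x ∷ L′} {c} len (x∉L′ ∷ uL′) P =
      suc k , ≡.cong suc (≡.trans (≡.cong suc (proj₁ (proj₂ IH))) (≡.sym (ℕ.+-suc k k))) , prod≈
      where
      open Pairing P
      x∈ : x ∈ x ∷ L′
      x∈ = here refl
      σx∈L′ : partner x ∈ L′
      σx∈L′ with partner-∈ x∈
      ... | here σx≈x = ⊥-elim (partner-≉ x∈ σx≈x)
      ... | there σx∈ = σx∈
      L″ = remove (partner x) L′
      ⊆L : ∀ {z} → z ∈ L″ → z ∈ x ∷ L′
      ⊆L z∈ = there (proj₁ (∈-remove⁻ z∈))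
      partner-∈″ : ∀ {z} → z ∈ L″ → partner z ∈ L″
      partner-∈″ {z} z∈ = ∈-remove⁺ σz∈L′ σx≉σz
        where
        z∈L′ = proj₁ (∈-remove⁻ z∈)
        σx≉σz : partner x ≉ partner z
        σx≉σz σx≈σz = MembershipProperties.All[≉]⇒∉ setoid x∉L′ (∈-resp-≈ (sym x≈z) z∈L′)
          where
          x≈z = trans (sym (partner-involutive x∈)) (trans (partner-cong (partner-∈ x∈) σx≈σz) (partner-involutive (there z∈L′)))
        σz∈L′ : partner z ∈ L′
        σz∈L′ with partner-∈ (there z∈L′)
        ... | there σz∈ = σz∈
        ... | here σz≈x = ⊥-elim (proj₂ (∈-remove⁻ {L = L′} z∈) (trans (partner-cong x∈ (sym σz≈x)) (partner-involutive (there z∈L′))))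
      P″ : Pairing L″ c
      P″ = record
        { partner = partner
        ; partner-cong = λ z∈ → partner-cong (⊆L z∈)
        ; partner-∈ = partner-∈″
        ; partner-≉ = λ z∈ → partner-≉ (⊆L z∈)
        ; partner-involutive = λ z∈ → partner-involutive (⊆L z∈)
        ; *-partner = λ z∈ → *-partner (⊆L z∈)
        }
      IH = go n (ℕ.suc-injective (≡.trans (≡.sym (length-remove σx∈L′ uL′)) (ℕ.suc-injective len))) (remove-unique (partner x) uL′) P″
      k = proj₁ IH
      prod≈ : prod (x ∷ L′) ≈ pow c (suc k)
      prod≈ = begin
        x * prod L′                  ≈⟨ *-congˡ (prod-remove σx∈L′ uL′) ⟩
        x * (partner x * prod L″)    ≈⟨ *-assoc _ _ _ ⟨
        (x * partner x) * prod L″    ≈⟨ *-cong (*-partner x∈) (proj₂ (proj₂ IH)) ⟩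
        c * pow c k                  ∎

  private
    index : Carrier → Fin m
    index y = proj₁ (Bijection.strictlySurjective enum y)

    element-index : ∀ y → Bijection.to enum (index y) ≈ y
    element-index y = proj₂ (Bijection.strictlySurjective enum y)

    index-cong : ∀ {y y′} → y ≈ y′ → index y ≡ index y′
    index-cong {y} {y′} y≈y′ = Bijection.injective enum (trans (element-index y) (trans y≈y′ (sym (element-index y′))))

    index-element : ∀ i → index (Bijection.to enum i) ≡ i
    index-element i = Bijection.injective enum (element-index _)

  elements : List Carrier
  elements = tabulate (Bijection.to enum)

  ∈-elements : ∀ y → y ∈ elements
  ∈-elements y = ∈-resp-≈ (element-index y) (MembershipProperties.∈-tabulate⁺ setoid (index y))

  elements-unique : Unique elements
  elements-unique = UniqueProperties.tabulate⁺ setoid (Bijection.injective enum)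

  length-elements : length elements ≡ m
  length-elements = List.length-tabulate _

  -- Translation by 1 permutes the elements, so adding m copies of 1 to
  -- their sum leaves the sum unchanged.
  characteristic∣order : fromℕ m ≈ 0#
  characteristic∣order = +-identityʳ-unique Σe (fromℕ m) (begin
    Σe + fromℕ m                         ≈⟨ +-congˡ (sum-1≈fromℕ m) ⟨
    Σe + sum {m} (λ _ → 1#)              ≈⟨ ∑-distrib-+ e (λ _ → 1#) ⟨
    sum (λ i → e i + 1#)                 ≈⟨ sum-cong-≋ (λ i → element-index (e i + 1#)) ⟨
    sum (λ i → e (index (e i + 1#)))     ≈⟨ sum-permute e shift ⟨
    Σe                                   ∎)
    where
    e = Bijection.to enum
    Σe = sum e
    sum-1≈fromℕ : ∀ n → sum {n} (λ _ → 1#) ≈ fromℕ n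
    sum-1≈fromℕ zero    = refl
    sum-1≈fromℕ (suc n) = +-congˡ (sum-1≈fromℕ n)
    shift : Permutation m m
    shift = permutation (λ i → index (e i + 1#)) (λ i → index (e i - 1#))
      (translate-back (- 1#) 1# (λ x → solve 1 (λ x → x ⊖ κ (+ 1) ⊕ κ (+ 1) ⊜ x) refl x))
      (translate-back 1# (- 1#) (λ x → solve 1 (λ x → x ⊕ κ (+ 1) ⊖ κ (+ 1) ⊜ x) refl x))
      where
      translate-back : ∀ a b → (∀ x → x + a + b ≈ x) → ∀ i → index (e (index (e i + a)) + b) ≡ i
      translate-back a b x+a+b≈x i = ≡.trans (index-cong (trans (+-congʳ (element-index _)) (x+a+b≈x (e i)))) (index-element i)

  sum-≈last : ∀ n (f : Fin (suc n) → Carrier) → (∀ i → toℕ i ℕ.< n → f i ≈ 0#) → sum f ≈ f (Fin.fromℕ n)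
  sum-≈last zero    f _      = +-identityʳ _
  sum-≈last (suc n) f f≈0 = begin
    f Fin.zero + sum (λ i → f (Fin.suc i))  ≈⟨ +-cong (f≈0 Fin.zero (ℕ.s≤s ℕ.z≤n)) (sum-≈last n (λ i → f (Fin.suc i)) (λ i i<n → f≈0 (Fin.suc i) (ℕ.s≤s i<n))) ⟩
    0# + f (Fin.suc (Fin.fromℕ n))          ≈⟨ +-identityˡ _ ⟩
    f (Fin.fromℕ (suc n))                   ∎

  -- The inner binomial coefficients C(p, j) are multiples of p, hence vanish.
  frobenius : ∀ {p} → Prime (suc p) → fromℕ (suc p) ≈ 0# → ∀ x y → pow (x + y) (suc p) ≈ pow x (suc p) + pow y (suc p)
  frobenius {p} p-prime p≈0 x y = begin
    pow (x + y) (suc p)                                   ≡⟨ pow≡^ (x + y) (suc p) ⟩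
    (x + y) ^ suc p                                       ≈⟨ binomial-theorem (suc p) x y ⟩
    binomialTerm x y (suc p) Fin.zero + sum inner         ≈⟨ +-congˡ (sum-≈last p inner (λ i i<p → multiple-of-p≈0 (prime∣pC[1+j] p-prime i<p))) ⟩
    binomialTerm x y (suc p) Fin.zero + inner (Fin.fromℕ p) ≈⟨ +-cong first last ⟩
    pow y (suc p) + pow x (suc p)                         ≈⟨ +-comm _ _ ⟩
    pow x (suc p) + pow y (suc p)                         ∎
    where
    inner : Fin (suc p) → Carrier
    inner i = binomialTerm x y (suc p) (Fin.suc i)
    multiple-of-p≈0 : ∀ {c z} → suc p ∣ c → c · z ≈ 0#
    multiple-of-p≈0 {c} {z} (divides k c≡k*p) = begin
      c · z                       ≈⟨ ·≈fromℕ* c z ⟩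
      fromℕ c * z                 ≡⟨ ≡.cong (λ w → fromℕ w * z) c≡k*p ⟩
      fromℕ (k ℕ.* suc p) * z     ≈⟨ *-congʳ (trans (fromℕ-* k (suc p)) (trans (*-congˡ p≈0) (zeroʳ _))) ⟩
      0# * z                      ≈⟨ zeroˡ z ⟩
      0#                          ∎
    first : binomialTerm x y (suc p) Fin.zero ≈ pow y (suc p)
    first = begin
      (x ^ 0 * y ^ suc p) + 0#    ≈⟨ +-identityʳ _ ⟩
      1# * y ^ suc p              ≈⟨ *-identityˡ _ ⟩
      y ^ suc p                   ≡⟨ pow≡^ y (suc p) ⟨
      pow y (suc p)               ∎
    last : inner (Fin.fromℕ p) ≈ pow x (suc p)
    last rewrite toℕ-fromℕ p | nCn≡1 (suc p) | ℕ.n∸n≡0 p = begin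
      (x ^ suc p * 1#) + 0#       ≈⟨ +-identityʳ _ ⟩
      x ^ suc p * 1#              ≈⟨ *-identityʳ _ ⟩
      x ^ suc p                   ≡⟨ pow≡^ x (suc p) ⟨
      pow x (suc p)               ∎

  module Subfield {p} (p-prime : Prime (suc p)) (p≈0 : fromℕ (suc p) ≈ 0#) (e : ℕ) where

    q : ℕ
    q = suc p ℕ.^ e

    frobenius-^ : ∀ e′ x y → pow (x + y) (suc p ℕ.^ e′) ≈ pow x (suc p ℕ.^ e′) + pow y (suc p ℕ.^ e′)
    frobenius-^ zero x y = begin
      (x + y) * 1#          ≈⟨ *-identityʳ _ ⟩
      x + y                 ≈⟨ +-cong (*-identityʳ x) (*-identityʳ y) ⟨
      x * 1# + y * 1#       ∎
    frobenius-^ (suc e′) x y = begin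
      pow (x + y) (suc p ℕ.* r)                   ≈⟨ pow-* (x + y) (suc p) r ⟩
      pow (pow (x + y) (suc p)) r                 ≈⟨ pow-cong r (frobenius p-prime p≈0 x y) ⟩
      pow (pow x (suc p) + pow y (suc p)) r       ≈⟨ frobenius-^ e′ (pow x (suc p)) (pow y (suc p)) ⟩
      pow (pow x (suc p)) r + pow (pow y (suc p)) r ≈⟨ +-cong (pow-* x (suc p) r) (pow-* y (suc p) r) ⟨
      pow x (suc p ℕ.* r) + pow y (suc p ℕ.* r)   ∎
      where r = suc p ℕ.^ e′

    pow-q-+ : ∀ x y → pow (x + y) q ≈ pow x q + pow y q
    pow-q-+ = frobenius-^ e

    pow-q-0 : pow 0# q ≈ 0#
    pow-q-0 with q | ℕ.m^n>0 (suc p) e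
    ... | suc q′ | _ = zeroˡ _

    pow-q-neg : ∀ x → pow (- x) q ≈ - pow x q
    pow-q-neg x = begin
      pow (- x) q                              ≈⟨ solve 2 (λ a b → a ⊜ ⊝ b ⊕ (b ⊕ a)) refl (pow (- x) q) (pow x q) ⟩
      - pow x q + (pow x q + pow (- x) q)      ≈⟨ +-congˡ (pow-q-+ x (- x)) ⟨
      - pow x q + pow (x - x) q                ≈⟨ +-congˡ (trans (pow-cong q (-‿inverseʳ x)) pow-q-0) ⟩
      - pow x q + 0#                           ≈⟨ +-identityʳ _ ⟩
      - pow x q                                ∎

    InFq-cong : ∀ {x y} → x ≈ y → InFq q x → InFq q y
    InFq-cong x≈y x∈ = trans (pow-cong q (sym x≈y)) (trans x∈ x≈y)

    InFq-0 : InFq q 0#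
    InFq-0 = pow-q-0

    InFq-1 : InFq q 1#
    InFq-1 = pow-1 q

    InFq-+ : ∀ {x y} → InFq q x → InFq q y → InFq q (x + y)
    InFq-+ x∈ y∈ = trans (pow-q-+ _ _) (+-cong x∈ y∈)

    InFq-* : ∀ {x y} → InFq q x → InFq q y → InFq q (x * y)
    InFq-* x∈ y∈ = trans (pow-distrib-* _ _ q) (*-cong x∈ y∈)

    InFq-neg : ∀ {x} → InFq q x → InFq q (- x)
    InFq-neg x∈ = trans (pow-q-neg _) (-‿cong x∈)

    InFq-⁻¹ : ∀ {x} → x ≉ 0# → InFq q x → InFq q (x ⁻¹)
    InFq-⁻¹ {x} x≉0 x∈ = trans (pow-⁻¹ q x≉0) (⁻¹-cong x∈ (pow-≉0 q x≉0))

    InFq-pow : ∀ {x} n → InFq q x → InFq q (pow x n)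
    InFq-pow zero    x∈ = InFq-1
    InFq-pow (suc n) x∈ = InFq-* x∈ (InFq-pow n x∈)

    InFq-fromℕ : ∀ n → InFq q (fromℕ n)
    InFq-fromℕ zero    = InFq-0
    InFq-fromℕ (suc n) = InFq-+ InFq-1 (InFq-fromℕ n)

    InFq-fromℤ : ∀ i → InFq q (fromℤ i)
    InFq-fromℤ (+ n)     = InFq-fromℕ n
    InFq-fromℤ -[1+ n ] = InFq-neg (InFq-fromℕ (suc n))

    InFq-sumTo : ∀ b f → (∀ i → InFq q (f i)) → InFq q (sumTo b f)
    InFq-sumTo zero    f f∈ = f∈ 0
    InFq-sumTo (suc b) f f∈ = InFq-+ (InFq-sumTo b f f∈) (f∈ (suc b))

    InFq-D : ∀ n k {x} → InFq q x → InFq q (D n k x)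
    InFq-D zero    k x∈ = InFq-fromℤ (+ 2 ℤ.- + k)
    InFq-D (suc n) k x∈ = InFq-sumTo (suc n ℕ./ 2) _ (λ i → InFq-* (InFq-fromℤ (coef (suc n) k i)) (InFq-pow i (InFq-neg x∈)))

  nonzero : List Carrier
  nonzero = remove 0# elements

  nonzero-unique : Unique nonzero
  nonzero-unique = remove-unique 0# elements-unique

  ∈-nonzero⁺ : ∀ {z} → z ≉ 0# → z ∈ nonzero
  ∈-nonzero⁺ z≉0 = ∈-remove⁺ (∈-elements _) (λ 0≈z → z≉0 (sym 0≈z))

  ∈-nonzero⁻ : ∀ {z} → z ∈ nonzero → z ≉ 0#
  ∈-nonzero⁻ z∈ z≈0 = proj₂ (∈-remove⁻ {L = elements} z∈) (sym z≈0)

  m≡1+length-nonzero : m ≡ suc (length nonzero)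
  m≡1+length-nonzero = ≡.trans (≡.sym length-elements) (length-remove (∈-elements 0#) elements-unique)

  ⁻¹-* : ∀ {a b} → a ≉ 0# → b ≉ 0# → (a * b) ⁻¹ ≈ a ⁻¹ * b ⁻¹
  ⁻¹-* {a} {b} a≉0 b≉0 = sym (⁻¹-unique (begin
    (a * b) * (a ⁻¹ * b ⁻¹)       ≈⟨ solve 4 (λ a b c d → (a ⊗ b) ⊗ (c ⊗ d) ⊜ (a ⊗ c) ⊗ (b ⊗ d)) refl a b (a ⁻¹) (b ⁻¹) ⟩
    (a * a ⁻¹) * (b * b ⁻¹)       ≈⟨ *-cong (inverseʳ a a≉0) (inverseʳ b b≉0) ⟩
    1# * 1#                       ≈⟨ *-identityʳ _ ⟩
    1#                            ∎))

  -- Wilson: pair every nonzero z ∉ {1, -1} with z⁻¹.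
  prod-nonzero≈-1 : 1# ≉ - 1# → prod nonzero ≈ - 1#
  prod-nonzero≈-1 1≉-1 = begin
    prod nonzero          ≈⟨ prod-remove (∈-nonzero⁺ 1≉0) nonzero-unique ⟩
    1# * prod L₁          ≈⟨ *-congˡ (prod-remove -1∈L₁ (remove-unique 1# nonzero-unique)) ⟩
    1# * (- 1# * prod L₂) ≈⟨ *-congˡ (*-congˡ (trans (proj₂ (proj₂ paired)) (pow-1 (proj₁ paired)))) ⟩
    1# * (- 1# * 1#)      ≈⟨ solve 0 (κ (+ 1) ⊗ (⊝ κ (+ 1) ⊗ κ (+ 1)) ⊜ ⊝ κ (+ 1)) refl ⟩
    - 1#                  ∎
    where
    L₁ = remove 1# nonzero
    L₂ = remove (- 1#) L₁
    -1≉0 : - 1# ≉ 0#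
    -1≉0 -1≈0 = 1≉0 (trans (sym (-‿involutive 1#)) (trans (-‿cong -1≈0) -0≈0))
    -1∈L₁ : - 1# ∈ L₁
    -1∈L₁ = ∈-remove⁺ (∈-nonzero⁺ -1≉0) 1≉-1
    ∈L₂⁻ : ∀ {z} → z ∈ L₂ → z ≉ 0# × 1# ≉ z × - 1# ≉ z
    ∈L₂⁻ z∈ with ∈-remove⁻ {L = L₁} z∈
    ... | z∈L₁ , -1≉z with ∈-remove⁻ {L = nonzero} z∈L₁
    ...   | z∈nonzero , 1≉z = ∈-nonzero⁻ z∈nonzero , 1≉z , -1≉z
    ⁻¹≈⇒≈ : ∀ {z c} → z ≉ 0# → z ⁻¹ ≈ c → c * c ≈ 1# → z ≈ c
    ⁻¹≈⇒≈ {z} {c} z≉0 z⁻¹≈c cc≈1 = trans (sym (⁻¹-involutive z≉0)) (trans (⁻¹-cong z⁻¹≈c (⁻¹-≉0 z≉0)) (sym (⁻¹-unique cc≈1)))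
    pairing : Pairing L₂ 1#
    pairing = record
      { partner            = _⁻¹
      ; partner-cong       = λ z∈ z≈w → ⁻¹-cong z≈w (proj₁ (∈L₂⁻ z∈))
      ; partner-∈          = partner-∈
      ; partner-≉          = partner-≉
      ; partner-involutive = λ z∈ → ⁻¹-involutive (proj₁ (∈L₂⁻ z∈))
      ; *-partner          = λ z∈ → inverseʳ _ (proj₁ (∈L₂⁻ z∈))
      }
      where
      partner-∈ : ∀ {z} → z ∈ L₂ → z ⁻¹ ∈ L₂
      partner-∈ z∈ with ∈L₂⁻ z∈
      ... | z≉0 , 1≉z , -1≉z = ∈-remove⁺ (∈-remove⁺ (∈-nonzero⁺ (⁻¹-≉0 z≉0))
              (λ 1≈z⁻¹ → 1≉z (sym (⁻¹≈⇒≈ z≉0 (sym 1≈z⁻¹) (*-identityʳ 1#)))))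
              (λ -1≈z⁻¹ → -1≉z (sym (⁻¹≈⇒≈ z≉0 (sym -1≈z⁻¹) (solve 0 (⊝ κ (+ 1) ⊗ ⊝ κ (+ 1) ⊜ κ (+ 1)) refl))))
      partner-≉ : ∀ {z} → z ∈ L₂ → z ⁻¹ ≉ z
      partner-≉ {z} z∈ z⁻¹≈z with ∈L₂⁻ z∈
      ... | z≉0 , 1≉z , -1≉z with x*y≈0⇒x≈0⊎y≈0 {z - 1#} {z + 1#} (begin
        (z - 1#) * (z + 1#)   ≈⟨ solve 1 (λ z → (z ⊖ κ (+ 1)) ⊗ (z ⊕ κ (+ 1)) ⊜ z ⊗ z ⊖ κ (+ 1)) refl z ⟩
        z * z - 1#            ≈⟨ +-congʳ (*-congˡ (sym z⁻¹≈z)) ⟩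
        z * z ⁻¹ - 1#         ≈⟨ +-congʳ (inverseʳ z z≉0) ⟩
        1# - 1#               ≈⟨ -‿inverseʳ 1# ⟩
        0#                    ∎)
      ... | inj₁ z-1≈0 = 1≉z (sym (x∙y⁻¹≈ε⇒x≈y z 1# z-1≈0))
      ... | inj₂ z+1≈0 = -1≉z (sym (x∙y⁻¹≈ε⇒x≈y z (- 1#) (trans (+-congˡ (-‿involutive 1#)) z+1≈0)))
    paired = Pairing⇒prod≈pow (remove-unique (- 1#) (remove-unique 1# nonzero-unique)) pairing

  -- Euler: for a non-square a, pair every nonzero z with a z⁻¹.
  non-square⇒pow≈-1 : 1# ≉ - 1# → ∀ {a} → a ≉ 0# → (∀ s → s * s ≉ a) → Σ ℕ λ k → m ≡ suc (k ℕ.+ k) × pow a k ≈ - 1#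
  non-square⇒pow≈-1 1≉-1 {a} a≉0 non-square =
    k , ≡.trans m≡1+length-nonzero (≡.cong suc (proj₁ (proj₂ paired))) , trans (sym (proj₂ (proj₂ paired))) (prod-nonzero≈-1 1≉-1)
    where
    z*az⁻¹≈a : ∀ {z} → z ≉ 0# → z * (a * z ⁻¹) ≈ a
    z*az⁻¹≈a {z} z≉0 = begin
      z * (a * z ⁻¹)   ≈⟨ x∙yz≈y∙xz z a (z ⁻¹) ⟩
      a * (z * z ⁻¹)   ≈⟨ *-congˡ (inverseʳ z z≉0) ⟩
      a * 1#           ≈⟨ *-identityʳ a ⟩
      a                ∎
    pairing : Pairing nonzero a
    pairing = record
      { partner            = λ z → a * z ⁻¹
      ; partner-cong       = λ z∈ z≈w → *-congˡ (⁻¹-cong z≈w (∈-nonzero⁻ z∈))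
      ; partner-∈          = λ z∈ → ∈-nonzero⁺ (*-≉0 a≉0 (⁻¹-≉0 (∈-nonzero⁻ z∈)))
      ; partner-≉          = λ {z} z∈ az⁻¹≈z → non-square z (trans (*-congˡ (sym az⁻¹≈z)) (z*az⁻¹≈a (∈-nonzero⁻ z∈)))
      ; partner-involutive = λ {z} z∈ → let z≉0 = ∈-nonzero⁻ z∈ in begin
          a * (a * z ⁻¹) ⁻¹           ≈⟨ *-congˡ (⁻¹-* a≉0 (⁻¹-≉0 z≉0)) ⟩
          a * (a ⁻¹ * (z ⁻¹) ⁻¹)      ≈⟨ *-congˡ (*-congˡ (⁻¹-involutive z≉0)) ⟩
          a * (a ⁻¹ * z)              ≈⟨ *-assoc _ _ _ ⟨
          (a * a ⁻¹) * z              ≈⟨ *-congʳ (inverseʳ a a≉0) ⟩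
          1# * z                      ≈⟨ *-identityˡ z ⟩
          z                           ∎
      ; *-partner          = λ z∈ → z*az⁻¹≈a (∈-nonzero⁻ z∈)
      }
    paired = Pairing⇒prod≈pow nonzero-unique pairing
    k = proj₁ paired

  square? : ∀ a → (Σ Carrier λ s → s * s ≈ a) ⊎ (∀ s → s * s ≉ a)
  square? a with any? (λ s → (s * s) ≟ a) elements
  ... | yes found = inj₁ (Any.satisfied found)
  ... | no none   = inj₂ (λ s ss≈a → none (Any.map (λ {t} s≈t → trans (*-cong (sym s≈t) (sym s≈t)) ss≈a) (∈-elements s)))

  sumTo-cong : ∀ B {f f′} → (∀ i → i ℕ.≤ B → f i ≈ f′ i) → sumTo B f ≈ sumTo B f′
  sumTo-cong zero    f≈f′ = f≈f′ 0 ℕ.z≤n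
  sumTo-cong (suc B) f≈f′ = +-cong (sumTo-cong B (λ i i≤B → f≈f′ i (ℕ.m≤n⇒m≤1+n i≤B))) (f≈f′ (suc B) ℕ.≤-refl)

  sumTo-+ : ∀ B f f′ → sumTo B (λ i → f i + f′ i) ≈ sumTo B f + sumTo B f′
  sumTo-+ zero    f f′ = refl
  sumTo-+ (suc B) f f′ = trans (+-congʳ (sumTo-+ B f f′)) (interchange _ _ _ _)

  sumTo-*ˡ : ∀ B c f → sumTo B (λ i → c * f i) ≈ c * sumTo B f
  sumTo-*ˡ zero    c f = refl
  sumTo-*ˡ (suc B) c f = trans (+-congʳ (sumTo-*ˡ B c f)) (sym (distribˡ _ _ _))

  sumTo-suc : ∀ B f → sumTo (suc B) f ≈ f 0 + sumTo B (λ i → f (suc i))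
  sumTo-suc zero    f = refl
  sumTo-suc (suc B) f = trans (+-congʳ (sumTo-suc B f)) (+-assoc _ _ _)

  sumTo-vanishing : ∀ B d f → (∀ j → B ℕ.≤ j → f (suc j) ≈ 0#) → sumTo (B ℕ.+ d) f ≈ sumTo B f
  sumTo-vanishing B zero    f _      = reflexive (≡.cong (λ b → sumTo b f) (ℕ.+-identityʳ B))
  sumTo-vanishing B (suc d) f vanish = begin
    sumTo (B ℕ.+ suc d) f                          ≡⟨ ≡.cong (λ b → sumTo b f) (ℕ.+-suc B d) ⟩
    sumTo (B ℕ.+ d) f + f (suc (B ℕ.+ d))          ≈⟨ +-cong (sumTo-vanishing B d f vanish) (vanish (B ℕ.+ d) (ℕ.m≤m+n B d)) ⟩
    sumTo B f + 0#                                 ≈⟨ +-identityʳ _ ⟩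
    sumTo B f                                      ∎

  -- E n t = Σᵢ C(n-i, i) tⁱ, so that D_{n,1}(1, x) = E n (-x); its terms vanish beyond n/2.
  E-partial : ℕ → ℕ → Carrier → Carrier
  E-partial n B t = sumTo B (λ i → fromℕ ((n ∸ i) C i) * pow t i)

  E : ℕ → Carrier → Carrier
  E n t = E-partial n n t

  E-partial-stable : ∀ n B t → n ℕ./ 2 ℕ.≤ B → E-partial n B t ≈ E-partial n (n ℕ./ 2) t
  E-partial-stable n B t n/2≤B = begin
    E-partial n B t                                    ≡⟨ ≡.cong (λ b → E-partial n b t) (ℕ.m+[n∸m]≡n n/2≤B) ⟨
    E-partial n (n ℕ./ 2 ℕ.+ (B ℕ.∸ n ℕ./ 2)) t        ≈⟨ sumTo-vanishing (n ℕ./ 2) _ _ vanish ⟩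
    E-partial n (n ℕ./ 2) t                            ∎
    where
    vanish : ∀ j → n ℕ./ 2 ℕ.≤ j → fromℕ ((n ∸ suc j) C suc j) * pow t (suc j) ≈ 0#
    vanish j n/2≤j = begin
      fromℕ ((n ∸ suc j) C suc j) * pow t (suc j)     ≡⟨ ≡.cong (λ c → fromℕ c * pow t (suc j)) (∸C-vanish n j n<2[1+j]) ⟩
      0# * pow t (suc j)                             ≈⟨ zeroˡ _ ⟩
      0#                                             ∎
      where
      n<2[1+j] = ℕ.<-≤-trans (n<[1+n/2]+[1+n/2] n) (ℕ.+-mono-≤ (ℕ.s≤s n/2≤j) (ℕ.s≤s n/2≤j))

  E-partial≈E : ∀ n B t → n ℕ./ 2 ℕ.≤ B → E-partial n B t ≈ E n t
  E-partial≈E n B t n/2≤B = trans (E-partial-stable n B t n/2≤B) (sym (E-partial-stable n n t (m/n≤m n 2)))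

  E-cong : ∀ n {t t′} → t ≈ t′ → E n t ≈ E n t′
  E-cong n t≈t′ = sumTo-cong n (λ i _ → *-congˡ (pow-cong i t≈t′))

  E-partial-rec : ∀ n B t → E-partial (suc (suc n)) (suc B) t ≈ E-partial (suc n) (suc B) t + t * E-partial n B t
  E-partial-rec n B t = begin
    E-partial (suc (suc n)) (suc B) t
      ≈⟨ sumTo-suc B _ ⟩
    c₀ + sumTo B (λ j → fromℕ ((suc n ∸ j) C suc j) * pow t (suc j))
      ≈⟨ +-congˡ (sumTo-cong B (λ j _ → pascal j)) ⟩
    c₀ + sumTo B (λ j → t * (fromℕ ((n ∸ j) C j) * pow t j) + fromℕ ((n ∸ j) C suc j) * pow t (suc j))
      ≈⟨ +-congˡ (trans (sumTo-+ B _ _) (+-congʳ (sumTo-*ˡ B t _))) ⟩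
    c₀ + (t * E-partial n B t + rest)
      ≈⟨ solve 3 (λ a b c → a ⊕ (b ⊕ c) ⊜ (a ⊕ c) ⊕ b) refl c₀ (t * E-partial n B t) rest ⟩
    (c₀ + rest) + t * E-partial n B t
      ≈⟨ +-congʳ (sumTo-suc B _) ⟨
    E-partial (suc n) (suc B) t + t * E-partial n B t ∎
    where
    c₀ = fromℕ 1 * 1#
    rest = sumTo B (λ j → fromℕ ((n ∸ j) C suc j) * pow t (suc j))
    pascal : ∀ j → fromℕ ((suc n ∸ j) C suc j) * pow t (suc j)
                 ≈ t * (fromℕ ((n ∸ j) C j) * pow t j) + fromℕ ((n ∸ j) C suc j) * pow t (suc j)
    pascal j = begin
      fromℕ ((suc n ∸ j) C suc j) * pow t (suc j)
        ≡⟨ ≡.cong (λ c → fromℕ c * pow t (suc j)) ([1+n∸j]C[1+j]≡[n∸j]Cj+[n∸j]C[1+j] n j) ⟩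
      fromℕ ((n ∸ j) C j ℕ.+ (n ∸ j) C suc j) * pow t (suc j)
        ≈⟨ *-congʳ (fromℕ-+ ((n ∸ j) C j) ((n ∸ j) C suc j)) ⟩
      (fromℕ ((n ∸ j) C j) + fromℕ ((n ∸ j) C suc j)) * (t * pow t j)
        ≈⟨ solve 4 (λ a b t w → (a ⊕ b) ⊗ (t ⊗ w) ⊜ t ⊗ (a ⊗ w) ⊕ b ⊗ (t ⊗ w)) refl _ _ t (pow t j) ⟩
      t * (fromℕ ((n ∸ j) C j) * pow t j) + fromℕ ((n ∸ j) C suc j) * pow t (suc j) ∎

  E-rec : ∀ n t → E (suc (suc n)) t ≈ E (suc n) t + t * E n t
  E-rec n t = trans (E-partial-rec n (suc n) t)
    (+-cong (E-partial≈E (suc n) (suc (suc n)) t (ℕ.m≤n⇒m≤1+n (m/n≤m (suc n) 2)))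
            (*-congˡ (E-partial≈E n (suc n) t (ℕ.m≤n⇒m≤1+n (m/n≤m n 2)))))

  -- h u v n = Σ_{i+j=n} uⁱ vʲ
  h : Carrier → Carrier → ℕ → Carrier
  h u v zero    = 1#
  h u v (suc n) = pow u (suc n) + v * h u v n

  h-rec : ∀ u v n → h u v (suc (suc n)) ≈ (u + v) * h u v (suc n) - u * v * h u v n
  h-rec u v n = solve 4 (λ u v w z → u ⊗ (u ⊗ w) ⊕ v ⊗ (u ⊗ w ⊕ v ⊗ z) ⊜ (u ⊕ v) ⊗ (u ⊗ w ⊕ v ⊗ z) ⊖ u ⊗ v ⊗ z)
    refl u v (pow u n) (h u v n)

  E≈h : ∀ {u v} → u + v ≈ 1# → ∀ n → E n (- (u * v)) ≈ h u v n
  E≈h {u} {v} u+v≈1 n = proj₁ (both n)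
    where
    t = - (u * v)
    both : ∀ n → E n t ≈ h u v n × E (suc n) t ≈ h u v (suc n)
    both zero = solve 0 ((κ (+ 1) ⊕ κ (+ 0)) ⊗ κ (+ 1) ⊜ κ (+ 1)) refl , (begin
      (1# + 0#) * 1# + 0# * (t * 1#)   ≈⟨ solve 1 (λ t → (κ (+ 1) ⊕ κ (+ 0)) ⊗ κ (+ 1) ⊕ κ (+ 0) ⊗ (t ⊗ κ (+ 1)) ⊜ κ (+ 1)) refl t ⟩
      1#                               ≈⟨ u+v≈1 ⟨
      u + v                            ≈⟨ +-cong (*-identityʳ u) (*-identityʳ v) ⟨
      u * 1# + v * 1#                  ∎)
    both (suc n) with both n
    ... | Eₙ≈hₙ , Eₙ₊₁≈hₙ₊₁ = Eₙ₊₁≈hₙ₊₁ , (begin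
      E (suc (suc n)) t                                   ≈⟨ E-rec n t ⟩
      E (suc n) t + t * E n t                             ≈⟨ +-cong Eₙ₊₁≈hₙ₊₁ (*-congˡ Eₙ≈hₙ) ⟩
      h u v (suc n) + t * h u v n                         ≈⟨ +-cong (trans (sym (*-identityˡ _)) (*-congʳ (sym u+v≈1))) (sym (-‿distribˡ-* _ _)) ⟩
      (u + v) * h u v (suc n) - u * v * h u v n           ≈⟨ h-rec u v n ⟨
      h u v (suc (suc n))                                 ∎)

  pow-sub≈[u-v]*h : ∀ u v n → pow u (suc n) - pow v (suc n) ≈ (u - v) * h u v n
  pow-sub≈[u-v]*h u v zero = solve 2 (λ u v → u ⊗ κ (+ 1) ⊖ v ⊗ κ (+ 1) ⊜ (u ⊖ v) ⊗ κ (+ 1)) refl u v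
  pow-sub≈[u-v]*h u v (suc n) = begin
    u * A - v * B                             ≈⟨ solve 4 (λ u v a b → u ⊗ a ⊖ v ⊗ b ⊜ (u ⊖ v) ⊗ a ⊕ v ⊗ (a ⊖ b)) refl u v A B ⟩
    (u - v) * A + v * (A - B)                 ≈⟨ +-congˡ (*-congˡ (pow-sub≈[u-v]*h u v n)) ⟩
    (u - v) * A + v * ((u - v) * h u v n)     ≈⟨ solve 4 (λ u v a c → (u ⊖ v) ⊗ a ⊕ v ⊗ ((u ⊖ v) ⊗ c) ⊜ (u ⊖ v) ⊗ (a ⊕ v ⊗ c)) refl u v A (h u v n) ⟩
    (u - v) * (A + v * h u v n)               ∎
    where
    A = pow u (suc n)
    B = pow v (suc n)

  h-u*h≈pow : ∀ u v n → h u v (suc n) - u * h u v n ≈ pow v (suc n)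
  h-u*h≈pow u v zero = solve 2 (λ u v → u ⊗ κ (+ 1) ⊕ v ⊗ κ (+ 1) ⊖ u ⊗ κ (+ 1) ⊜ v ⊗ κ (+ 1)) refl u v
  h-u*h≈pow u v (suc n) = begin
    (u * A + v * h u v (suc n)) - u * (A + v * h u v n)
      ≈⟨ solve 5 (λ u v a c d → (u ⊗ a ⊕ v ⊗ c) ⊖ u ⊗ (a ⊕ v ⊗ d) ⊜ v ⊗ (c ⊖ u ⊗ d)) refl u v A (h u v (suc n)) (h u v n) ⟩
    v * (h u v (suc n) - u * h u v n)     ≈⟨ *-congˡ (h-u*h≈pow u v n) ⟩
    v * pow v (suc n)                     ∎
    where
    A = pow u (suc n)

  fromℤ-coef : ∀ n k i → i ℕ.≤ suc n ℕ./ 2 →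
    fromℤ (coef (suc n) k i) ≈ fromℕ ((suc n ∸ i) C i) + (1# - fromℕ k) * fromℕ (shiftedC (suc n) i)
  fromℤ-coef n k i i≤ = begin
    fromℤ (coef (suc n) k i)
      ≡⟨ ≡.cong fromℤ (coef≡C+[1-k]*shiftedC (suc n) k i (≤[1+n]/2⇒[1+n]∸i≡suc n i i≤)) ⟩
    fromℤ (+ c ℤ.+ (+ 1 ℤ.- + k) ℤ.* + c′)
      ≈⟨ fromℤ-+ (+ c) ((+ 1 ℤ.- + k) ℤ.* + c′) ⟩
    fromℕ c + fromℤ ((+ 1 ℤ.- + k) ℤ.* + c′)
      ≈⟨ +-congˡ (trans (fromℤ-* (+ 1 ℤ.- + k) (+ c′)) (*-congʳ (trans (fromℤ-sub (+ 1) (+ k)) (+-congʳ (+-identityʳ 1#))))) ⟩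
    fromℕ c + (1# - fromℕ k) * fromℕ c′ ∎
    where
    c  = (suc n ∸ i) C i
    c′ = shiftedC (suc n) i

  D-split : ∀ n k x → D (suc n) k x ≈
    E (suc n) (- x) + (1# - fromℕ k) * sumTo (suc n ℕ./ 2) (λ i → fromℕ (shiftedC (suc n) i) * pow (- x) i)
  D-split n k x = begin
    D (suc n) k x
      ≈⟨ sumTo-cong B (λ i i≤B → trans (*-congʳ (fromℤ-coef n k i i≤B)) (distribute _ _ _ _)) ⟩
    sumTo B (λ i → fromℕ ((suc n ∸ i) C i) * pow t i + (1# - fromℕ k) * (fromℕ (shiftedC (suc n) i) * pow t i))
      ≈⟨ trans (sumTo-+ B _ _) (+-congˡ (sumTo-*ˡ B _ _)) ⟩
    E-partial (suc n) B t + (1# - fromℕ k) * sumTo B (λ i → fromℕ (shiftedC (suc n) i) * pow t i)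
      ≈⟨ +-congʳ (E-partial≈E (suc n) B t ℕ.≤-refl) ⟩
    E (suc n) t + (1# - fromℕ k) * sumTo B (λ i → fromℕ (shiftedC (suc n) i) * pow t i) ∎
    where
    B = suc n ℕ./ 2
    t = - x
    distribute : ∀ c a c′ w → (c + a * c′) * w ≈ c * w + a * (c′ * w)
    distribute = solve 4 (λ c a c′ w → (c ⊕ a ⊗ c′) ⊗ w ⊜ c ⊗ w ⊕ a ⊗ (c′ ⊗ w)) refl

  D-1 : ∀ k x → D 1 k x ≈ 1#
  D-1 k x = trans (D-split 0 k x)
    (solve 2 (λ c t → (κ (+ 1) ⊕ κ (+ 0)) ⊗ κ (+ 1) ⊕ κ (+ 0) ⊗ (t ⊗ κ (+ 1)) ⊕ (κ (+ 1) ⊖ c) ⊗ (κ (+ 0) ⊗ κ (+ 1)) ⊜ κ (+ 1))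
      refl (fromℕ k) (- x))

  D-2+ : ∀ n k x → D (suc (suc n)) k x ≈ E (suc (suc n)) (- x) + (1# - fromℕ k) * (- x * E n (- x))
  D-2+ n k x = trans (D-split (suc n) k x) (+-congˡ (*-congˡ shifted≈))
    where
    t = - x
    shifted≈ : sumTo (suc (suc n) ℕ./ 2) (λ i → fromℕ (shiftedC (suc (suc n)) i) * pow t i) ≈ t * E n t
    shifted≈ = begin
      sumTo (suc (suc n) ℕ./ 2) (λ i → fromℕ (shiftedC (suc (suc n)) i) * pow t i)
        ≡⟨ ≡.cong (λ b → sumTo b (λ i → fromℕ (shiftedC (suc (suc n)) i) * pow t i)) ([2+n]/2≡1+n/2 n) ⟩
      sumTo (suc (n ℕ./ 2)) (λ i → fromℕ (shiftedC (suc (suc n)) i) * pow t i)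
        ≈⟨ sumTo-suc (n ℕ./ 2) _ ⟩
      0# * 1# + sumTo (n ℕ./ 2) (λ j → fromℕ ((n ∸ j) C j) * (t * pow t j))
        ≈⟨ trans (+-congʳ (zeroˡ 1#)) (+-identityˡ _) ⟩
      sumTo (n ℕ./ 2) (λ j → fromℕ ((n ∸ j) C j) * (t * pow t j))
        ≈⟨ sumTo-cong (n ℕ./ 2) (λ j _ → x∙yz≈y∙xz _ t _) ⟩
      sumTo (n ℕ./ 2) (λ j → t * (fromℕ ((n ∸ j) C j) * pow t j))
        ≈⟨ sumTo-*ˡ (n ℕ./ 2) t _ ⟩
      t * E-partial n (n ℕ./ 2) t
        ≈⟨ *-congˡ (E-partial≈E n (n ℕ./ 2) t ℕ.≤-refl) ⟩
      t * E n t ∎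

  toX : Carrier → Carrier
  toX y = y * (1# - y)

  toX-cong : ∀ {y y′} → y ≈ y′ → toX y ≈ toX y′
  toX-cong y≈y′ = *-cong y≈y′ (+-congˡ (-‿cong y≈y′))

  toX-flip : ∀ y → toX (1# - y) ≈ toX y
  toX-flip = solve 1 (λ y → (κ (+ 1) ⊖ y) ⊗ (κ (+ 1) ⊖ (κ (+ 1) ⊖ y)) ⊜ y ⊗ (κ (+ 1) ⊖ y)) refl

  toX-injective-up-to-flip : ∀ {y₁ y₂} → toX y₁ ≈ toX y₂ → y₂ ≈ y₁ ⊎ y₂ ≈ 1# - y₁
  toX-injective-up-to-flip {y₁} {y₂} eq with x*y≈0⇒x≈0⊎y≈0 {y₂ - y₁} {y₂ - (1# - y₁)} (begin
    (y₂ - y₁) * (y₂ - (1# - y₁))   ≈⟨ solve 2 (λ a b → (b ⊖ a) ⊗ (b ⊖ (κ (+ 1) ⊖ a)) ⊜ a ⊗ (κ (+ 1) ⊖ a) ⊖ b ⊗ (κ (+ 1) ⊖ b)) refl y₁ y₂ ⟩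
    toX y₁ - toX y₂                ≈⟨ x≈y⇒x∙y⁻¹≈ε eq ⟩
    0#                             ∎)
  ... | inj₁ d≈0 = inj₁ (x∙y⁻¹≈ε⇒x≈y _ _ d≈0)
  ... | inj₂ d≈0 = inj₂ (x∙y⁻¹≈ε⇒x≈y _ _ d≈0)

  toX-equal : ∀ {y₁ y₂} → y₂ ≈ y₁ ⊎ y₂ ≈ 1# - y₁ → toX y₁ ≈ toX y₂
  toX-equal (inj₁ y₂≈y₁)   = toX-cong (sym y₂≈y₁)
  toX-equal {y₁} (inj₂ y₂≈) = trans (sym (toX-flip y₁)) (toX-cong (sym y₂≈))

  g≈D∘toX : ∀ k n {y} → two * y - 1# ≉ 0# → g k n y ≈ D n k (toX y)
  g≈D∘toX k zero {y} w≉0 = begin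
    fromℕ k * ((1# * (1# - y) - y * 1#) * w ⁻¹) + 1# + 1#
      ≈⟨ +-congʳ (+-congʳ (*-congˡ (*-congʳ (solve 1 (λ y → κ (+ 1) ⊗ (κ (+ 1) ⊖ y) ⊖ y ⊗ κ (+ 1) ⊜ ⊝ (κ (+ 2) ⊗ y ⊖ κ (+ 1))) refl y)))) ⟩
    fromℕ k * (- w * w ⁻¹) + 1# + 1#
      ≈⟨ +-congʳ (+-congʳ (*-congˡ (trans (sym (-‿distribˡ-* w (w ⁻¹))) (-‿cong (inverseʳ w w≉0))))) ⟩
    fromℕ k * (- 1#) + 1# + 1#
      ≈⟨ solve 1 (λ c → c ⊗ (⊝ κ (+ 1)) ⊕ κ (+ 1) ⊕ κ (+ 1) ⊜ (κ (+ 1) ⊕ (κ (+ 1) ⊕ κ (+ 0))) ⊖ c) refl (fromℕ k) ⟩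
    fromℤ (+ 2) - fromℕ k
      ≈⟨ fromℤ-sub (+ 2) (+ k) ⟨
    D zero k (y * (1# - y)) ∎
    where w = two * y - 1#
  g≈D∘toX k (suc zero) {y} w≉0 = begin
    fromℕ k * ((y * 1# * (1# - y) - y * ((1# - y) * 1#)) * w ⁻¹) + y * 1# + (1# - y) * 1#
      ≈⟨ solve 3 (λ c y w → c ⊗ ((y ⊗ κ (+ 1) ⊗ (κ (+ 1) ⊖ y) ⊖ y ⊗ ((κ (+ 1) ⊖ y) ⊗ κ (+ 1))) ⊗ w) ⊕ y ⊗ κ (+ 1) ⊕ (κ (+ 1) ⊖ y) ⊗ κ (+ 1) ⊜ κ (+ 1))
           refl (fromℕ k) y (w ⁻¹) ⟩
    1#
      ≈⟨ D-1 k (y * (1# - y)) ⟨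
    D 1 k (y * (1# - y)) ∎
    where w = two * y - 1#
  g≈D∘toX k (suc (suc n)) {y} w≉0 = begin
    fromℕ k * ((u * A * v - u * (v * B)) * w ⁻¹) + u * A + v * B
      ≈⟨ +-congʳ (+-congʳ (*-congˡ (*-congʳ numerator≈))) ⟩
    fromℕ k * ((u * v * hₙ) * w * w ⁻¹) + u * A + v * B
      ≈⟨ +-congʳ (+-congʳ (*-congˡ (trans (*-assoc _ _ _) (trans (*-congˡ (inverseʳ w w≉0)) (*-identityʳ _))))) ⟩
    fromℕ k * (u * v * hₙ) + u * A + v * B
      ≈⟨ +-congˡ (*-congˡ (h-u*h≈pow u v n)) ⟨
    fromℕ k * (u * v * hₙ) + u * A + v * (hₙ₊₁ - u * hₙ)
      ≈⟨ solve 6 (λ c u v a h₁ h₀ → c ⊗ (u ⊗ v ⊗ h₀) ⊕ u ⊗ a ⊕ v ⊗ (h₁ ⊖ u ⊗ h₀) ⊜ (u ⊗ a ⊕ v ⊗ h₁) ⊕ (κ (+ 1) ⊖ c) ⊗ (⊝ (u ⊗ v) ⊗ h₀))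
           refl (fromℕ k) u v A hₙ₊₁ hₙ ⟩
    h u v (suc (suc n)) + (1# - fromℕ k) * (- (u * v) * hₙ)
      ≈⟨ +-cong (E≈h u+v≈1 (suc (suc n))) (*-congˡ (*-congˡ (E≈h u+v≈1 n))) ⟨
    E (suc (suc n)) (- (u * v)) + (1# - fromℕ k) * (- (u * v) * E n (- (u * v)))
      ≈⟨ D-2+ n k (u * v) ⟨
    D (suc (suc n)) k (y * (1# - y)) ∎
    where
    u = y
    v = 1# - y
    w = two * y - 1#
    A = pow u (suc n)
    B = pow v (suc n)
    hₙ = h u v n
    hₙ₊₁ = h u v (suc n)
    u+v≈1 : u + v ≈ 1#
    u+v≈1 = solve 1 (λ y → y ⊕ (κ (+ 1) ⊖ y) ⊜ κ (+ 1)) refl y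
    numerator≈ : u * A * v - u * (v * B) ≈ (u * v * hₙ) * w
    numerator≈ = begin
      u * A * v - u * (v * B)     ≈⟨ solve 4 (λ u v a b → u ⊗ a ⊗ v ⊖ u ⊗ (v ⊗ b) ⊜ u ⊗ v ⊗ (a ⊖ b)) refl u v A B ⟩
      u * v * (A - B)             ≈⟨ *-congˡ (pow-sub≈[u-v]*h u v n) ⟩
      u * v * ((u - v) * hₙ)      ≈⟨ solve 2 (λ y c → y ⊗ (κ (+ 1) ⊖ y) ⊗ ((y ⊖ (κ (+ 1) ⊖ y)) ⊗ c) ⊜ (y ⊗ (κ (+ 1) ⊖ y) ⊗ c) ⊗ (κ (+ 2) ⊗ y ⊖ κ (+ 1))) refl y hₙ ⟩
      (u * v * hₙ) * w            ∎

  module _ (two≉0 : two ≉ 0#) where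

    two*half≈1 : two * half ≈ 1#
    two*half≈1 = inverseʳ two two≉0

    1-half≈half : 1# - half ≈ half
    1-half≈half = begin
      1# - half            ≈⟨ +-congʳ two*half≈1 ⟨
      two * half - half    ≈⟨ solve 1 (λ c → κ (+ 2) ⊗ c ⊖ c ⊜ c) refl half ⟩
      half                 ∎

    h-half : ∀ n → h half half n ≈ fromℕ (suc n) * pow half n
    h-half zero    = solve 0 (κ (+ 1) ⊜ (κ (+ 1) ⊕ κ (+ 0)) ⊗ κ (+ 1)) refl
    h-half (suc n) = begin
      half * pow half n + half * h half half n                    ≈⟨ +-congˡ (*-congˡ (h-half n)) ⟩
      half * pow half n + half * (fromℕ (suc n) * pow half n)    ≈⟨ solve 3 (λ c p a → c ⊗ p ⊕ c ⊗ (a ⊗ p) ⊜ (κ (+ 1) ⊕ a) ⊗ (c ⊗ p)) refl half (pow half n) (fromℕ (suc n)) ⟩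
      (1# + fromℕ (suc n)) * (half * pow half n)                 ∎

    excluded≈ : ∀ k n → excluded k n ≈ (fromℕ k * (fromℕ n - fromℕ 1) + fromℕ 2) * pow half n
    excluded≈ k n = *-cong
      (trans (fromℤ-+ (+ k ℤ.* (+ n ℤ.- + 1)) (+ 2)) (+-congʳ (trans (fromℤ-* (+ k) (+ n ℤ.- + 1)) (*-congˡ (fromℤ-sub (+ n) (+ 1))))))
      (sym (pow-⁻¹ n two≉0))

    D∘toX-half≈excluded : ∀ k n → D n k (toX half) ≈ excluded k n
    D∘toX-half≈excluded k zero = begin
      fromℤ (+ 2 ℤ.- + k)                      ≈⟨ fromℤ-sub (+ 2) (+ k) ⟩
      fromℕ 2 - fromℕ k                        ≈⟨ solve 1 (λ c → (κ (+ 1) ⊕ (κ (+ 1) ⊕ κ (+ 0))) ⊖ c ⊜ (c ⊗ (κ (+ 0) ⊖ (κ (+ 1) ⊕ κ (+ 0))) ⊕ (κ (+ 1) ⊕ (κ (+ 1) ⊕ κ (+ 0)))) ⊗ κ (+ 1)) refl (fromℕ k) ⟩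
      (fromℕ k * (0# - fromℕ 1) + fromℕ 2) * 1#  ≈⟨ excluded≈ k zero ⟨
      excluded k zero                          ∎
    D∘toX-half≈excluded k (suc zero) = begin
      D 1 k (half * (1# - half))                            ≈⟨ D-1 k (half * (1# - half)) ⟩
      1#                                                    ≈⟨ two*half≈1 ⟨
      two * half                                            ≈⟨ *-congʳ (solve 1 (λ c → κ (+ 2) ⊜ c ⊗ ((κ (+ 1) ⊕ κ (+ 0)) ⊖ (κ (+ 1) ⊕ κ (+ 0))) ⊕ (κ (+ 1) ⊕ (κ (+ 1) ⊕ κ (+ 0)))) refl (fromℕ k)) ⟩
      (fromℕ k * (fromℕ 1 - fromℕ 1) + fromℕ 2) * half        ≈⟨ *-congˡ (*-identityʳ half) ⟨
      (fromℕ k * (fromℕ 1 - fromℕ 1) + fromℕ 2) * pow half 1  ≈⟨ excluded≈ k 1 ⟨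
      excluded k 1                                          ∎
    D∘toX-half≈excluded k (suc (suc n)) = begin
      D (suc (suc n)) k x
        ≈⟨ D-2+ n k x ⟩
      E (suc (suc n)) (- x) + (1# - fromℕ k) * (- x * E n (- x))
        ≈⟨ +-cong (E-cong (suc (suc n)) -x≈) (*-congˡ (*-cong -x≈ (E-cong n -x≈))) ⟩
      E (suc (suc n)) (- (half * half)) + (1# - fromℕ k) * (- (half * half) * E n (- (half * half)))
        ≈⟨ +-cong (trans (E≈h half+half≈1 (suc (suc n))) (h-half (suc (suc n)))) (*-congˡ (*-congˡ (trans (E≈h half+half≈1 n) (h-half n)))) ⟩
      fromℕ (3 ℕ.+ n) * pow half (2 ℕ.+ n) + (1# - fromℕ k) * (- (half * half) * (fromℕ (suc n) * pow half n))
        ≈⟨ solve 4 (λ c a s p →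
              (κ (+ 1) ⊕ (κ (+ 1) ⊕ (κ (+ 1) ⊕ a))) ⊗ (s ⊗ (s ⊗ p)) ⊕ (κ (+ 1) ⊖ c) ⊗ (⊝ (s ⊗ s) ⊗ ((κ (+ 1) ⊕ a) ⊗ p))
              ⊜ (c ⊗ ((κ (+ 1) ⊕ (κ (+ 1) ⊕ a)) ⊖ (κ (+ 1) ⊕ κ (+ 0))) ⊕ (κ (+ 1) ⊕ (κ (+ 1) ⊕ κ (+ 0)))) ⊗ (s ⊗ (s ⊗ p)))
             refl (fromℕ k) (fromℕ n) half (pow half n) ⟩
      (fromℕ k * (fromℕ (2 ℕ.+ n) - fromℕ 1) + fromℕ 2) * pow half (2 ℕ.+ n)
        ≈⟨ excluded≈ k (suc (suc n)) ⟨
      excluded k (suc (suc n)) ∎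
      where
      x = half * (1# - half)
      -x≈ : - x ≈ - (half * half)
      -x≈ = -‿cong (*-congˡ 1-half≈half)
      half+half≈1 : half + half ≈ 1#
      half+half≈1 = trans (solve 1 (λ c → c ⊕ c ⊜ κ (+ 2) ⊗ c) refl half) two*half≈1

  D-cong : ∀ n k {x x′} → x ≈ x′ → D n k x ≈ D n k x′
  D-cong zero    k x≈x′ = refl
  D-cong (suc n) k x≈x′ = sumTo-cong (suc n ℕ./ 2) (λ i _ → *-congˡ (pow-cong i (-‿cong x≈x′)))

  map-unique : ∀ f {L} → Unique L → (∀ {x y} → x ∈ L → y ∈ L → f x ≈ f y → x ≈ y) → Unique (map f L)
  map-unique f {[]}    _            _   = []
  map-unique f {x ∷ L} (x∉L ∷ uL) inj =
    All.map⁺ (All.tabulateₛ setoid (λ {y} y∈L fx≈fy → MembershipProperties.All[≉]⇒∉ setoid x∉L (∈-resp-≈ (sym (inj (here refl) (there y∈L) fx≈fy)) y∈L)))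
    ∷ map-unique f uL (λ x∈ y∈ → inj (there x∈) (there y∈))

  -- An injective self-map of a finite subset hits every element: otherwise its
  -- image would be a duplicate-free list inside the subset minus one point.
  injectiveOn⇒surjectiveOn : ∀ {P : Carrier → Set} → Decidable P → P Respects _≈_ →
    ∀ f → (∀ {x y} → x ≈ y → f x ≈ f y) → (∀ {x} → P x → P (f x)) →
    (∀ {x y} → P x → P y → f x ≈ f y → x ≈ y) → ∀ {z} → P z → ∃ λ x → P x × f x ≈ z
  injectiveOn⇒surjectiveOn {P} P? resp f f-cong f-into f-inj {z} Pz = search (any? (λ x → P? x ×-dec (f x ≟ z)) Lᴾ)
    where
    Lᴾ = filter P? elements
    Lᴾ-unique = UniqueProperties.filter⁺ setoid P? elements-unique
    ∈⇒P : ∀ {x} → x ∈ Lᴾ → P x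
    ∈⇒P x∈ = proj₂ (MembershipProperties.∈-filter⁻ setoid P? resp {xs = elements} x∈)
    P⇒∈ : ∀ {x} → P x → x ∈ Lᴾ
    P⇒∈ Px = MembershipProperties.∈-filter⁺ setoid P? resp (∈-elements _) Px
    search : Dec (Any (λ x → P x × f x ≈ z) Lᴾ) → ∃ λ x → P x × f x ≈ z
    search (yes hit) = Any.satisfied hit
    search (no miss) = ⊥-elim (ℕ.1+n≰n (ℕ.≤-trans (ℕ.≤-reflexive length≡) image-bound))
      where
      image⊆ : ∀ {w} → w ∈ map f Lᴾ → w ∈ remove z Lᴾ
      image⊆ w∈ with MembershipProperties.∈-map⁻ setoid setoid w∈
      ... | x , x∈ , w≈fx = ∈-resp-≈ (sym w≈fx) (∈-remove⁺ (P⇒∈ (f-into (∈⇒P x∈)))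
              (λ z≈fx → miss (Any.map (λ {t} x≈t → resp x≈t (∈⇒P x∈) , trans (f-cong (sym x≈t)) (sym z≈fx)) x∈)))
      length≡ : suc (length (remove z Lᴾ)) ≡ length (map f Lᴾ)
      length≡ = ≡.trans (≡.sym (length-remove (P⇒∈ Pz) Lᴾ-unique)) (≡.sym (List.length-map f Lᴾ))
      image-bound = ⊆⇒length≤ (map-unique f Lᴾ-unique (λ x∈ y∈ → f-inj (∈⇒P x∈) (∈⇒P y∈))) (remove-unique z Lᴾ-unique) image⊆

  module FieldOfOrderQ² {p} (p-prime : Prime (suc p)) (p-odd : suc p % 2 ≡ 1) (e : ℕ) (m≡q² : m ≡ suc p ℕ.^ e ℕ.* suc p ℕ.^ e) where

    p≈0 : fromℕ (suc p) ≈ 0#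
    p≈0 with fromℕ (suc p) ≟ 0#
    ... | yes p≈0 = p≈0
    ... | no p≉0  = ⊥-elim (*-≉0 (pow-≉0 e p≉0) (pow-≉0 e p≉0) (begin
      pow (fromℕ (suc p)) e * pow (fromℕ (suc p)) e       ≈⟨ *-cong (fromℕ-^ (suc p) e) (fromℕ-^ (suc p) e) ⟨
      fromℕ (suc p ℕ.^ e) * fromℕ (suc p ℕ.^ e)           ≈⟨ fromℕ-* (suc p ℕ.^ e) (suc p ℕ.^ e) ⟨
      fromℕ (suc p ℕ.^ e ℕ.* suc p ℕ.^ e)                 ≡⟨ ≡.cong fromℕ m≡q² ⟨
      fromℕ m                                             ≈⟨ characteristic∣order ⟩
      0#                                                  ∎))

    half-p : ℕ
    half-p = proj₁ (odd⇒1+2* (suc p) p-odd)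

    p≡1+2r : suc p ≡ suc (half-p ℕ.+ half-p)
    p≡1+2r = proj₂ (odd⇒1+2* (suc p) p-odd)

    two≉0 : two ≉ 0#
    two≉0 2≈0 = 1≉0 (begin
      1#                                      ≈⟨ +-identityʳ 1# ⟨
      1# + 0#                                 ≈⟨ +-congˡ (trans (*-congʳ 2≈0) (zeroˡ _)) ⟨
      1# + two * fromℕ r                      ≈⟨ +-congˡ (trans (*-congʳ (+-congˡ (sym (+-identityʳ 1#)))) (sym (fromℕ-* 2 r))) ⟩
      fromℕ (suc (2 ℕ.* r))                   ≡⟨ ≡.cong (λ r′ → fromℕ (suc (r ℕ.+ r′))) (ℕ.+-identityʳ r) ⟩
      fromℕ (suc (r ℕ.+ r))                   ≡⟨ ≡.cong fromℕ p≡1+2r ⟨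
      fromℕ (suc p)                           ≈⟨ p≈0 ⟩
      0#                                      ∎)
      where r = half-p

    1≉-1 : 1# ≉ - 1#
    1≉-1 1≈-1 = two≉0 (trans (+-congˡ 1≈-1) (-‿inverseʳ 1#))

    open Subfield p-prime p≈0 e

    InFq-half : InFq q half
    InFq-half = InFq-⁻¹ two≉0 (InFq-+ InFq-1 InFq-1)

    pow-q-[1-y] : ∀ y → pow (1# - y) q ≈ 1# - pow y q
    pow-q-[1-y] y = trans (pow-q-+ 1# (- y)) (+-cong InFq-1 (pow-q-neg y))

    -- Every a ∈ F_q^× is a square in F_{q²}: a^(q-1) = 1, whereas a non-square
    -- would have a^((q²-1)/2) = -1, and (q²-1)/2 is a multiple of q - 1.
    InFq⇒square : ∀ {a} → a ≉ 0# → InFq q a → Σ Carrier λ s → s * s ≈ a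
    InFq⇒square {a} a≉0 a∈ with square? a
    ... | inj₁ square = square
    ... | inj₂ non-square with non-square⇒pow≈-1 1≉-1 a≉0 non-square | odd-^ half-p p≡1+2r e
    ...   | k , m≡1+2k , aᵏ≈-1 | r , q≡1+2r = ⊥-elim (1≉-1 (begin
      1#                                   ≈⟨ pow-1 (suc r) ⟨
      pow 1# (suc r)                       ≈⟨ pow-cong (suc r) a²ʳ≈1 ⟨
      pow (pow a (r ℕ.+ r)) (suc r)        ≈⟨ pow-* a (r ℕ.+ r) (suc r) ⟨
      pow a ((r ℕ.+ r) ℕ.* suc r)          ≡⟨ ≡.cong (pow a) k≡ ⟨
      pow a k                              ≈⟨ aᵏ≈-1 ⟩
      - 1#                                 ∎))
      where
      a²ʳ≈1 : pow a (r ℕ.+ r) ≈ 1#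
      a²ʳ≈1 = *-cancelˡ a a≉0 (trans (≡.subst (λ n → pow a n ≈ a) q≡1+2r a∈) (sym (*-identityʳ a)))
      square-odd : ∀ r → suc (r ℕ.+ r) ℕ.* suc (r ℕ.+ r) ≡ suc ((r ℕ.+ r) ℕ.* suc r ℕ.+ (r ℕ.+ r) ℕ.* suc r)
      square-odd = ℕ-Solver.solve-∀
      k≡ : k ≡ (r ℕ.+ r) ℕ.* suc r
      k≡ = m+m≡n+n⇒m≡n k _ (ℕ.suc-injective (≡.trans (≡.sym m≡1+2k) (≡.trans m≡q² (≡.trans (≡.cong₂ ℕ._*_ q≡1+2r q≡1+2r) (square-odd r)))))

    2y-1≉0 : ∀ {y} → y ≉ half → two * y - 1# ≉ 0#
    2y-1≉0 y≉half 2y-1≈0 = y≉half (⁻¹-unique (x∙y⁻¹≈ε⇒x≈y _ _ 2y-1≈0))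

    toX≉toX-half : ∀ {y} → y ≉ half → toX y ≉ toX half
    toX≉toX-half {y} y≉half eq with toX-injective-up-to-flip eq
    ... | inj₁ half≈y   = y≉half (sym half≈y)
    ... | inj₂ half≈1-y = y≉half (begin
      y                ≈⟨ solve 1 (λ y → y ⊜ κ (+ 1) ⊖ (κ (+ 1) ⊖ y)) refl y ⟩
      1# - (1# - y)    ≈⟨ +-congˡ (-‿cong half≈1-y) ⟨
      1# - half        ≈⟨ 1-half≈half two≉0 ⟩
      half             ∎)

    InFq-toX : ∀ {y} → InS q y → InFq q (toX y)
    InFq-toX (inj₁ y∈Fq , _) = InFq-* y∈Fq (InFq-+ InFq-1 (InFq-neg y∈Fq))
    InFq-toX {y} (inj₂ y∈V , _) = begin
      pow (y * (1# - y)) q           ≈⟨ pow-distrib-* y (1# - y) q ⟩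
      pow y q * pow (1# - y) q       ≈⟨ *-congˡ (pow-q-[1-y] y) ⟩
      pow y q * (1# - pow y q)       ≈⟨ toX-cong y∈V ⟩
      toX (1# - y)                   ≈⟨ toX-flip y ⟩
      toX y                          ∎

    pow-q-sqrt : ∀ {s} → InFq q (s * s) → pow s q ≈ s ⊎ pow s q ≈ - s
    pow-q-sqrt {s} s²∈ with x*y≈0⇒x≈0⊎y≈0 {pow s q - s} {pow s q + s} (begin
      (pow s q - s) * (pow s q + s)     ≈⟨ solve 2 (λ a s → (a ⊖ s) ⊗ (a ⊕ s) ⊜ a ⊗ a ⊖ s ⊗ s) refl (pow s q) s ⟩
      pow s q * pow s q - s * s         ≈⟨ +-congʳ (pow-distrib-* s s q) ⟨
      pow (s * s) q - s * s             ≈⟨ x≈y⇒x∙y⁻¹≈ε s²∈ ⟩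
      0#                                ∎)
    ... | inj₁ d≈0 = inj₁ (x∙y⁻¹≈ε⇒x≈y _ _ d≈0)
    ... | inj₂ d≈0 = inj₂ (x∙y⁻¹≈ε⇒x≈y _ _ (trans (+-congˡ (-‿involutive s)) d≈0))

    x≈[1-Δ]/4 : ∀ x → x ≈ (1# - (1# - two * two * x)) * (half * half)
    x≈[1-Δ]/4 x = begin
      x                                            ≈⟨ *-identityʳ x ⟨
      x * 1#                                       ≈⟨ *-congˡ (trans (*-cong 2half≈1 2half≈1) (*-identityʳ 1#)) ⟨
      x * ((two * half) * (two * half))            ≈⟨ solve 3 (λ x t c → x ⊗ ((t ⊗ c) ⊗ (t ⊗ c)) ⊜ (κ (+ 1) ⊖ (κ (+ 1) ⊖ t ⊗ t ⊗ x)) ⊗ (c ⊗ c)) refl x two half ⟩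
      (1# - (1# - two * two * x)) * (half * half)  ∎
      where 2half≈1 = two*half≈1 two≉0

    ≉toX-half⇒discriminant≉0 : ∀ {x} → x ≉ toX half → 1# - two * two * x ≉ 0#
    ≉toX-half⇒discriminant≉0 {x} x≉¼ Δ≈0 = x≉¼ (begin
      x                                            ≈⟨ x≈[1-Δ]/4 x ⟩
      (1# - (1# - two * two * x)) * (half * half)  ≈⟨ *-congʳ (+-congˡ (-‿cong Δ≈0)) ⟩
      (1# - 0#) * (half * half)                    ≈⟨ solve 1 (λ c → (κ (+ 1) ⊖ κ (+ 0)) ⊗ c ⊜ c) refl (half * half) ⟩
      half * half                                  ≈⟨ *-congˡ (1-half≈half two≉0) ⟨
      toX half                                     ∎)

    -- The roots of y(1 - y) = x are (1 ± s)/2 with s² = 1 - 4x, and the two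
    -- possible signs of s^q put them in F_q or in V.
    toX-root : ∀ {x s} → InFq q (s * s) → s * s ≈ 1# - two * two * x → s ≉ 0# →
               InS q ((1# + s) * half) × toX ((1# + s) * half) ≈ x
    toX-root {x} {s} s²∈ s²≈ s≉0 = (in-Fq-or-V , y≉half) , toX-y≈x
      where
      y = (1# + s) * half
      1-y≈ : 1# - y ≈ (1# - s) * half
      1-y≈ = begin
        1# - y                          ≈⟨ +-congʳ (two*half≈1 two≉0) ⟨
        two * half - (1# + s) * half    ≈⟨ solve 2 (λ s c → κ (+ 2) ⊗ c ⊖ (κ (+ 1) ⊕ s) ⊗ c ⊜ (κ (+ 1) ⊖ s) ⊗ c) refl s half ⟩
        (1# - s) * half                 ∎
      toX-y≈x : toX y ≈ x
      toX-y≈x = begin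
        y * (1# - y)                                   ≈⟨ *-congˡ 1-y≈ ⟩
        ((1# + s) * half) * ((1# - s) * half)          ≈⟨ solve 2 (λ s c → ((κ (+ 1) ⊕ s) ⊗ c) ⊗ ((κ (+ 1) ⊖ s) ⊗ c) ⊜ (κ (+ 1) ⊖ s ⊗ s) ⊗ (c ⊗ c)) refl s half ⟩
        (1# - s * s) * (half * half)                   ≈⟨ *-congʳ (+-congˡ (-‿cong s²≈)) ⟩
        (1# - (1# - two * two * x)) * (half * half)    ≈⟨ x≈[1-Δ]/4 x ⟨
        x                                              ∎
      y≉half : y ≉ half
      y≉half y≈half = s≉0 (begin
        s                                                   ≈⟨ solve 2 (λ s c → s ⊜ (κ (+ 1) ⊕ s) ⊗ c ⊗ κ (+ 2) ⊖ κ (+ 1) ⊕ (κ (+ 1) ⊖ κ (+ 2) ⊗ c) ⊕ s ⊗ (κ (+ 1) ⊖ κ (+ 2) ⊗ c)) refl s half ⟩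
        (y * two - 1#) + (1# - two * half) + s * (1# - two * half)
          ≈⟨ +-cong (+-cong (x≈y⇒x∙y⁻¹≈ε 2y≈1) 1-2half≈0) (*-congˡ 1-2half≈0) ⟩
        0# + 0# + s * 0#                                    ≈⟨ solve 1 (λ s → κ (+ 0) ⊕ κ (+ 0) ⊕ s ⊗ κ (+ 0) ⊜ κ (+ 0)) refl s ⟩
        0#                                                  ∎)
        where
        1-2half≈0 = x≈y⇒x∙y⁻¹≈ε (sym (two*half≈1 two≉0))
        2y≈1 = trans (*-congʳ y≈half) (trans (*-comm half two) (two*half≈1 two≉0))
      pow-q-y : pow y q ≈ (1# + pow s q) * half
      pow-q-y = trans (pow-distrib-* (1# + s) half q) (*-cong (trans (pow-q-+ 1# s) (+-congʳ InFq-1)) InFq-half)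
      in-Fq-or-V : InFq q y ⊎ InV q y
      in-Fq-or-V with pow-q-sqrt s²∈
      ... | inj₁ sᵠ≈s  = inj₁ (trans pow-q-y (*-congʳ (+-congˡ sᵠ≈s)))
      ... | inj₂ sᵠ≈-s = inj₂ (trans pow-q-y (trans (*-congʳ (+-congˡ sᵠ≈-s)) (sym 1-y≈)))

    toX-surjective : ∀ {x} → InFq q x → x ≉ toX half → Σ Carrier λ y → InS q y × toX y ≈ x
    toX-surjective {x} x∈ x≉¼ = (1# + s) * half , toX-root (InFq-cong (sym s²≈Δ) Δ∈) s²≈Δ s≉0
      where
      Δ≉0 = ≉toX-half⇒discriminant≉0 x≉¼
      Δ∈ : InFq q (1# - two * two * x)
      Δ∈ = InFq-+ InFq-1 (InFq-neg (InFq-* (InFq-* two∈ two∈) x∈))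
        where two∈ = InFq-+ InFq-1 InFq-1
      s = proj₁ (InFq⇒square Δ≉0 Δ∈)
      s²≈Δ = proj₂ (InFq⇒square Δ≉0 Δ∈)
      s≉0 : s ≉ 0#
      s≉0 s≈0 = Δ≉0 (trans (sym s²≈Δ) (trans (*-congˡ s≈0) (zeroʳ s)))

    InFq-toX-half : InFq q (toX half)
    InFq-toX-half = InFq-* InFq-half (InFq-+ InFq-1 (InFq-neg InFq-half))

    InS⇒g≈D∘toX : ∀ k n {y} → InS q y → g k n y ≈ D n k (toX y)
    InS⇒g≈D∘toX k n (_ , y≉half) = g≈D∘toX k n (2y-1≉0 y≉half)

    module _ (k n : ℕ) where

      InjectiveOnFq : Set
      InjectiveOnFq = ∀ x y → InFq q x → InFq q y → D n k x ≈ D n k y → x ≈ y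

      injective⇒twoToOne : InjectiveOnFq → TwoToOneOnS q k n
      injective⇒twoToOne inj y₁ y₂ y₁∈ y₂∈ = mk⇔
        (λ g≈g → toX-injective-up-to-flip (inj _ _ (InFq-toX y₁∈) (InFq-toX y₂∈) (trans (sym (InS⇒g≈D∘toX k n y₁∈)) (trans g≈g (InS⇒g≈D∘toX k n y₂∈)))))
        (λ same → trans (InS⇒g≈D∘toX k n y₁∈) (trans (D-cong n k (toX-equal same)) (sym (InS⇒g≈D∘toX k n y₂∈))))

      injective⇒avoidsExcluded : InjectiveOnFq → AvoidsExcluded q k n
      injective⇒avoidsExcluded inj y (y∈ , y≉half) g≈ex = toX≉toX-half y≉half
        (inj _ _ (InFq-toX (y∈ , y≉half)) InFq-toX-half (trans (sym (InS⇒g≈D∘toX k n (y∈ , y≉half))) (trans g≈ex (sym (D∘toX-half≈excluded two≉0 k n)))))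

      avoidsExcluded⇒D≉D-toX-half : AvoidsExcluded q k n → ∀ {x} → InFq q x → x ≉ toX half → D n k x ≉ D n k (toX half)
      avoidsExcluded⇒D≉D-toX-half avoids {x} x∈ x≉¼ D≈ = refute (toX-surjective x∈ x≉¼)
        where
        refute : (Σ Carrier λ y → InS q y × toX y ≈ x) → ⊥
        refute (y , y∈ , toX-y≈x) = avoids y y∈ (begin
          g k n y              ≈⟨ InS⇒g≈D∘toX k n y∈ ⟩
          D n k (toX y)        ≈⟨ D-cong n k toX-y≈x ⟩
          D n k x              ≈⟨ D≈ ⟩
          D n k (toX half)     ≈⟨ D∘toX-half≈excluded two≉0 k n ⟩
          excluded k n         ∎)

      twoToOne⇒preimages-injective : TwoToOneOnS q k n → ∀ {x₁ x₂} → D n k x₁ ≈ D n k x₂ →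
        (Σ Carrier λ y → InS q y × toX y ≈ x₁) → (Σ Carrier λ y → InS q y × toX y ≈ x₂) → x₁ ≈ x₂
      twoToOne⇒preimages-injective twoToOne {x₁} {x₂} D≈D (y₁ , y₁∈ , toX-y₁≈) (y₂ , y₂∈ , toX-y₂≈) = begin
        x₁        ≈⟨ toX-y₁≈ ⟨
        toX y₁    ≈⟨ toX-equal (Equivalence.to (twoToOne y₁ y₂ y₁∈ y₂∈) g≈g) ⟩
        toX y₂    ≈⟨ toX-y₂≈ ⟩
        x₂        ∎
        where
        g≈g : g k n y₁ ≈ g k n y₂
        g≈g = begin
          g k n y₁            ≈⟨ InS⇒g≈D∘toX k n y₁∈ ⟩
          D n k (toX y₁)      ≈⟨ D-cong n k toX-y₁≈ ⟩
          D n k x₁            ≈⟨ D≈D ⟩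
          D n k x₂            ≈⟨ D-cong n k toX-y₂≈ ⟨
          D n k (toX y₂)      ≈⟨ InS⇒g≈D∘toX k n y₂∈ ⟨
          g k n y₂            ∎

      conditions⇒injective : TwoToOneOnS q k n → AvoidsExcluded q k n → InjectiveOnFq
      conditions⇒injective twoToOne avoids x₁ x₂ x₁∈ x₂∈ D≈D with x₁ ≟ toX half | x₂ ≟ toX half
      ... | yes x₁≈¼ | yes x₂≈¼ = trans x₁≈¼ (sym x₂≈¼)
      ... | yes x₁≈¼ | no x₂≉¼  = ⊥-elim (avoidsExcluded⇒D≉D-toX-half avoids x₂∈ x₂≉¼ (trans (sym D≈D) (D-cong n k x₁≈¼)))
      ... | no x₁≉¼  | yes x₂≈¼ = ⊥-elim (avoidsExcluded⇒D≉D-toX-half avoids x₁∈ x₁≉¼ (trans D≈D (D-cong n k x₂≈¼)))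
      ... | no x₁≉¼  | no x₂≉¼  =
        twoToOne⇒preimages-injective twoToOne D≈D (toX-surjective x₁∈ x₁≉¼) (toX-surjective x₂∈ x₂≉¼)

      permutation⇔conditions : IsPermutationPolynomial q (D n k) ⇔ (TwoToOneOnS q k n × AvoidsExcluded q k n)
      permutation⇔conditions = mk⇔
        (λ (_ , inj , _) → injective⇒twoToOne inj , injective⇒avoidsExcluded inj)
        (λ (twoToOne , avoids) → let inj = conditions⇒injective twoToOne avoids in
          (λ _ → InFq-D n k) ,
          inj ,
          (λ z z∈ → injectiveOn⇒surjectiveOn (λ x → pow x q ≟ x) InFq-cong (D n k) (D-cong n k) (InFq-D n k) (λ {x} {y} → inj x y) z∈))

open import Data.Nat using (_^_; _*_; _<_; _≤_)

theorem2p20 : (p : ℕ) → Prime p → p % 2 ≡ 1 →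
    (e : ℕ) → 1 ≤ e →
    (F : FieldOfOrder ((p ^ e) * (p ^ e))) →
    (k : ℕ) → k < p → (n : ℕ) →
    FF.IsPermutationPolynomial F (p ^ e) (FF.D F n k)
      ⇔ (FF.TwoToOneOnS F (p ^ e) k n × FF.AvoidsExcluded F (p ^ e) k n)
theorem2p20 (suc p) p-prime p-odd e _ F k _ n =
  FieldOfOrderQ².permutation⇔conditions F p-prime p-odd e ≡.refl k n
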